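{- Let $\mathbb{F}$ be a finite field with $q$ elements and $n\ge 2$ an integer. Let $N=\frac{q^n-1}{q-1}$ and let $v_1,\dots,v_N$ be an enumeration of the $1$-dimensional subspaces of $\mathbb{F}^n$. Let $K$ be a field of characteristic zero and $F=\sum X_{i_1}\cdots X_{i_n}\in K[X_1,\dots,X_N]$, summed over all $1\le i_1<\cdots<i_n\le N$ such that $v_{i_1},\dots,v_{i_n}$ form a basis of $\mathbb{F}^n$. Let $H(F)=\left(\frac{\partial^2F}{\partial X_i\partial X_j}\right)_{1\le i,j\le N}$ be its Hessian matrix. Let $A=(a_{ij})$ be the $N\times N$ matrix with $a_{ij}=1$ if $v_i\in v_j^\perp$ and $0$ otherwise, where $v^\perp=\{w:\sum_k v_kw_k=0\}$, and let $B=(1-a_{ij})$. Then $H(F)\big|_{X_1=\cdots=X_N=1}=\frac{t_{n-1,1,q}}{(n-2)!}\,AB$, where $t_{n-1,1,q}=q^{(n-1)(n-2)/2}\prod_{k=1}^{n-2}\frac{q^k-1}{q-1}$. -}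

module Defs where

open import Level using (Level; _⊔_) renaming (suc to lsuc)
open import Data.Nat as ℕ using (ℕ; zero; suc; _∸_)
open import Data.Nat.DivMod using (_/_)
open import Data.Nat.Base using (_!)
open import Data.Fin as Fin using (Fin)
open import Data.Fin.Properties using () renaming (_≟_ to _≟ᶠ_)
open import Data.Vec using (Vec; []; _∷_; lookup)
open import Data.List using (List; []; _∷_; map; _++_; allFin; concatMap; foldr)
open import Data.Bool using (Bool; true; false; if_then_else_)
open import Data.Product using (Σ; ∃; _×_; _,_)
open import Relation.Nullary using (¬_; Dec; yes; no; does)
open import Relation.Binary using (Decidable)
open import Relation.Binary.PropositionalEquality using (_≡_)
open import Algebra.Bundles using (CommutativeRing)

module RingOps {c ℓ} (R : CommutativeRing c ℓ) where
  open CommutativeRing R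

  ∑ : ∀ {m} → (Fin m → Carrier) → Carrier
  ∑ {zero}  f = 0#
  ∑ {suc m} f = f Fin.zero + ∑ (λ k → f (Fin.suc k))

  ∏ : ∀ {m} → (Fin m → Carrier) → Carrier
  ∏ {zero}  f = 1#
  ∏ {suc m} f = f Fin.zero * ∏ (λ k → f (Fin.suc k))

  fromℕ : ℕ → Carrier
  fromℕ zero    = 0#
  fromℕ (suc m) = 1# + fromℕ m

  infixr 8 _^_
  _^_ : Carrier → ℕ → Carrier
  x ^ zero  = 1#
  x ^ suc m = x * x ^ m

record FiniteField (c ℓ : Level) : Set (lsuc (c ⊔ ℓ)) where
  field
    commRing : CommutativeRing c ℓ
  open CommutativeRing commRing
  field
    _≟_       : Decidable _≈_
    0≉1       : ¬ (0# ≈ 1#)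
    inverse   : ∀ x → ¬ (x ≈ 0#) → ∃ λ y → x * y ≈ 1#
    q         : ℕ
    enum      : Fin q → Carrier
    enum-surj : ∀ x → ∃ λ i → enum i ≈ x
    enum-inj  : ∀ i j → enum i ≈ enum j → i ≡ j

-- Fields, presented with a total inverse map (0⁻¹ unconstrained)
record Field (c ℓ : Level) : Set (lsuc (c ⊔ ℓ)) where
  field
    commRing : CommutativeRing c ℓ
  open CommutativeRing commRing
  field
    _⁻¹      : Carrier → Carrier
    0≉1      : ¬ (0# ≈ 1#)
    inverseʳ : ∀ x → ¬ (x ≈ 0#) → x * (x ⁻¹) ≈ 1#

CharacteristicZero : ∀ {c ℓ} → Field c ℓ → Set ℓ
CharacteristicZero K = ∀ m → fromℕ m ≈ 0# → m ≡ 0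
  where open Field K; open CommutativeRing commRing; open RingOps commRing

module LinAlg {c ℓ} (𝔽 : FiniteField c ℓ) where
  open FiniteField 𝔽
  open CommutativeRing commRing
  open RingOps commRing

  Vecⁿ : ℕ → Set c
  Vecⁿ n = Fin n → Carrier

  IsZeroVec : ∀ {n} → Vecⁿ n → Set ℓ
  IsZeroVec w = ∀ k → w k ≈ 0#

  lincomb : ∀ {m n} → (Fin m → Carrier) → (Fin m → Vecⁿ n) → Vecⁿ n
  lincomb cs ws k = ∑ (λ a → cs a * ws a k)

  LinearlyIndependent : ∀ {m n} → (Fin m → Vecⁿ n) → Set (c ⊔ ℓ)
  LinearlyIndependent ws = ∀ cs → IsZeroVec (lincomb cs ws) → ∀ a → cs a ≈ 0#

  Spans : ∀ {m n} → (Fin m → Vecⁿ n) → Set (c ⊔ ℓ)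
  Spans {n = n} ws = ∀ (x : Vecⁿ n) → ∃ λ cs → ∀ k → lincomb cs ws k ≈ x k

  IsBasis : ∀ {m n} → (Fin m → Vecⁿ n) → Set (c ⊔ ℓ)
  IsBasis ws = LinearlyIndependent ws × Spans ws

  dot : ∀ {n} → Vecⁿ n → Vecⁿ n → Carrier
  dot v w = ∑ (λ k → v k * w k)

  -- v : Fin N → 𝔽ⁿ is an enumeration (by representatives) of the
  -- 1-dimensional subspaces of 𝔽ⁿ: the line spanned by v i is the i-th one.
  IsLineEnumeration : ∀ {N n} → (Fin N → Vecⁿ n) → Set (c ⊔ ℓ)
  IsLineEnumeration {N} {n} v =
    (∀ i → ¬ IsZeroVec (v i))
    × (∀ i j (s : Carrier) → (∀ k → v i k ≈ s * v j k) → i ≡ j)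
    × (∀ (w : Vecⁿ n) → ¬ IsZeroVec w → ∃ λ i → ∃ λ (s : Carrier) → ∀ k → w k ≈ s * v i k)

-- Strictly increasing k-tuples from a list (in the list's order)
choose : ∀ {a} {A : Set a} (k : ℕ) → List A → List (Vec A k)
choose zero    xs       = [] ∷ []
choose (suc k) []       = []
choose (suc k) (x ∷ xs) = map (x ∷_) (choose k xs) ++ choose (suc k) xs

exponents : ∀ {N m} → Vec (Fin N) m → Fin N → ℕ
exponents []      j = 0
exponents (i ∷ t) j = (if does (i ≟ᶠ j) then 1 else 0) ℕ.+ exponents t j

module Poly {c ℓ} (R : CommutativeRing c ℓ) (N : ℕ) where
  open CommutativeRing R
  open RingOps R

  record Term : Set c where
    constructor term
    field
      coeff : Carrier
      expo  : Fin N → ℕ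

  Polynomial : Set c
  Polynomial = List Term

  ∂ : Fin N → Polynomial → Polynomial
  ∂ i = map (λ { (term a e) →
              term (fromℕ (e i) * a)
                   (λ j → if does (j ≟ᶠ i) then e j ∸ 1 else e j) })

  eval : (Fin N → Carrier) → Polynomial → Carrier
  eval x = foldr (λ { (term a e) acc → a * ∏ (λ j → x j ^ e j) + acc }) 0#

-- (q^k - 1)/(q - 1), for q ≥ 2 (junk value 0 for q < 2)
qint : ℕ → ℕ → ℕ
qint (suc (suc r)) k = (suc (suc r) ℕ.^ k ∸ 1) / suc r
qint _             k = 0

prodℕ : ℕ → (ℕ → ℕ) → ℕ
prodℕ zero    f = 1
prodℕ (suc m) f = prodℕ m f ℕ.* f (suc m)

t-coeff : (n q : ℕ) → ℕ
t-coeff n q = q ℕ.^ (((n ∸ 1) ℕ.* (n ∸ 2)) / 2) ℕ.* prodℕ (n ∸ 2) (qint q)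

module Setup {c ℓ c' ℓ'} (𝔽 : FiniteField c ℓ) (K : Field c' ℓ') where
  private
    module 𝔽 = FiniteField 𝔽
    module 𝔽R = CommutativeRing 𝔽.commRing
    module K = Field K
    module KR = CommutativeRing K.commRing
  open LinAlg 𝔽 public
  open RingOps K.commRing public

  module _ {n N : ℕ} (v : Fin N → Vecⁿ n)
           (basis? : (t : Vec (Fin N) n) → Dec (IsBasis (λ a → v (lookup t a)))) where
    open Poly K.commRing N public

    F : Polynomial
    F = concatMap (λ t → if does (basis? t) then term KR.1# (exponents t) ∷ [] else [])
                  (choose n (allFin N))

    H-at-1 : Fin N → Fin N → KR.Carrier
    H-at-1 i j = eval (λ _ → KR.1#) (∂ i (∂ j F))

  module _ {n N : ℕ} (v : Fin N → Vecⁿ n) where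
    A : Fin N → Fin N → KR.Carrier
    A i j = if does (dot (v i) (v j) 𝔽.≟ 𝔽R.0#) then KR.1# else KR.0#

    B : Fin N → Fin N → KR.Carrier
    B i j = KR.1# KR.- A i j

    AB : Fin N → Fin N → KR.Carrier
    AB i j = ∑ (λ k → A i k KR.* B k j)

  scalar : ℕ → KR.Carrier
  scalar n = fromℕ (t-coeff n 𝔽.q) KR.* (fromℕ ((n ∸ 2) !) K.⁻¹)

module Submission where

-- ∂ᵢ∂ⱼF evaluated at 1 counts the bases of 𝔽ⁿ, taken as sets of lines, that contain vᵢ and vⱼ.
-- For i = j it vanishes because F is squarefree, and so does (AB)ᵢᵢ, which counts the lines that
-- are both in and outside vᵢ⊥. For i ≠ j, listing the other n − 2 lines in order and picking a
-- nonzero vector on each gives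
--   (n − 2)! (q − 1)ⁿ⁻² · #bases = (qⁿ − q²)(qⁿ − q³)⋯(qⁿ − qⁿ⁻¹) = (q − 1)ⁿ⁻² qⁿ⁻² t_{n−1,1,q},
-- while (AB)ᵢⱼ counts the lines of vᵢ⊥ outside vⱼ⊥: as vᵢ⊥ ∩ vⱼ⊥ has dimension n − 2, there are
-- (qⁿ⁻¹ − qⁿ⁻²)/(q − 1) = qⁿ⁻² of them.

open import Defs
open import Data.Nat using (ℕ; suc)
open import Data.Fin using (Fin) renaming (zero to fz)
open import Data.Fin.Properties using () renaming (_≟_ to _≟F_)
open import Data.Vec using (Vec; lookup)
open import Relation.Nullary using (Dec)
import Data.Fin.Properties
open import Relation.Binary.Definitions using (DecidableEquality)
open import Algebra.Bundles using (CommutativeRing)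

module Counting where

  open import Data.Nat using (ℕ; zero; suc; _+_; _*_; _^_; _≤_; z≤n; s≤s)
  open import Data.Nat.Properties
  open import Data.Nat.Tactic.RingSolver using (solve-∀)
  open import Data.Bool using (Bool; true; false; _∧_; not)
  open import Data.List using (List; []; _∷_; map; _++_; concatMap; tabulate; allFin)
  open import Data.List.Relation.Unary.All using (All; []; _∷_)
  open import Data.Fin using (Fin) renaming (zero to fz; suc to fs)
  open import Data.Fin.Properties using () renaming (suc-injective to fs-injective; _≟_ to _≟F_)
  open import Data.Vec using (Vec) renaming ([] to []v; _∷_ to _∷v_)
  open import Data.Product using (_×_; _,_; proj₁; proj₂; ∃)
  open import Data.Sum using (_⊎_; inj₁; inj₂)
  open import Data.Empty using (⊥; ⊥-elim)
  open import Relation.Nullary using (¬_; Dec; yes; no; does)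
  open import Relation.Binary.PropositionalEquality
  open import Relation.Binary.Definitions using (DecidableEquality)

  sumL : ∀ {a} {A : Set a} → (A → ℕ) → List A → ℕ
  sumL f []       = 0
  sumL f (x ∷ xs) = f x + sumL f xs

  𝟙 : Bool → ℕ
  𝟙 true  = 1
  𝟙 false = 0

  δ : ∀ {p} {P : Set p} → Dec P → ℕ
  δ (yes _) = 1
  δ (no _)  = 0

  module _ {a} {A : Set a} where

    sumL-cong : ∀ {f g : A → ℕ} xs → (∀ x → f x ≡ g x) → sumL f xs ≡ sumL g xs
    sumL-cong []       e = refl
    sumL-cong (x ∷ xs) e = cong₂ _+_ (e x) (sumL-cong xs e)

    sumL-zero : ∀ xs → sumL (λ (_ : A) → 0) xs ≡ 0
    sumL-zero []       = refl
    sumL-zero (x ∷ xs) = sumL-zero xs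

    sumL-+ : ∀ (f g : A → ℕ) xs → sumL (λ x → f x + g x) xs ≡ sumL f xs + sumL g xs
    sumL-+ f g []       = refl
    sumL-+ f g (x ∷ xs) rewrite sumL-+ f g xs = interchange (f x) (g x) (sumL f xs) (sumL g xs)
      where
      interchange : ∀ a b c d → a + b + (c + d) ≡ a + c + (b + d)
      interchange = solve-∀

    sumL-*ˡ : ∀ c (f : A → ℕ) xs → sumL (λ x → c * f x) xs ≡ c * sumL f xs
    sumL-*ˡ c f []       = sym (*-zeroʳ c)
    sumL-*ˡ c f (x ∷ xs) rewrite sumL-*ˡ c f xs = sym (*-distribˡ-+ c (f x) _)

    sumL-*ʳ : ∀ c (f : A → ℕ) xs → sumL (λ x → f x * c) xs ≡ sumL f xs * c
    sumL-*ʳ c f xs = trans (sumL-cong xs (λ x → *-comm (f x) c)) (trans (sumL-*ˡ c f xs) (*-comm c _))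

    sumL-++ : ∀ (f : A → ℕ) xs ys → sumL f (xs ++ ys) ≡ sumL f xs + sumL f ys
    sumL-++ f []       ys = refl
    sumL-++ f (x ∷ xs) ys rewrite sumL-++ f xs ys = sym (+-assoc (f x) _ _)

    sumL-mono-≤ : ∀ {f g : A → ℕ} xs → (∀ x → f x ≤ g x) → sumL f xs ≤ sumL g xs
    sumL-mono-≤ []       e = z≤n
    sumL-mono-≤ (x ∷ xs) e = +-mono-≤ (e x) (sumL-mono-≤ xs e)

  module _ {a b} {A : Set a} {B : Set b} where

    sumL-map : ∀ (f : B → ℕ) (g : A → B) xs → sumL f (map g xs) ≡ sumL (λ x → f (g x)) xs
    sumL-map f g []       = refl
    sumL-map f g (x ∷ xs) = cong (f (g x) +_) (sumL-map f g xs)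

    sumL-concatMap : ∀ (f : B → ℕ) (g : A → List B) xs →
      sumL f (concatMap g xs) ≡ sumL (λ x → sumL f (g x)) xs
    sumL-concatMap f g []       = refl
    sumL-concatMap f g (x ∷ xs) = trans (sumL-++ f (g x) _) (cong (sumL f (g x) +_) (sumL-concatMap f g xs))

    sumL-comm : ∀ (M : A → B → ℕ) xs ys →
      sumL (λ x → sumL (M x) ys) xs ≡ sumL (λ y → sumL (λ x → M x y) xs) ys
    sumL-comm M []       ys = sym (sumL-zero ys)
    sumL-comm M (x ∷ xs) ys rewrite sumL-comm M xs ys = sym (sumL-+ (M x) (λ y → sumL (λ x → M x y) xs) ys)

  record Enum (A : Set) : Set where
    field
      elems : List A
      deq   : DecidableEquality A
      once  : ∀ a → sumL (λ x → δ (deq x a)) elems ≡ 1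
  open Enum public

  module _ {A : Set} (E : Enum A) where

    count : (A → Bool) → ℕ
    count P = sumL (λ x → 𝟙 (P x)) (elems E)

    total : ℕ
    total = count (λ _ → true)

    sumL-δ : (R : A → ℕ) (a : A) → (∀ x → R x ≡ δ (deq E x a)) → sumL R (elems E) ≡ 1
    sumL-δ R a e = trans (sumL-cong (elems E) e) (once E a)

    sumL-δ* : (g : A → ℕ) (a : A) → sumL (λ x → δ (deq E x a) * g x) (elems E) ≡ g a
    sumL-δ* g a = trans (sumL-cong (elems E) pointwise)
      (trans (sumL-*ʳ (g a) (λ x → δ (deq E x a)) (elems E)) (trans (cong (_* g a) (once E a)) (+-identityʳ (g a))))
      where
      pointwise : ∀ x → δ (deq E x a) * g x ≡ δ (deq E x a) * g a
      pointwise x with deq E x a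
      ... | yes refl = refl
      ... | no _     = refl

    count-cong : (P Q : A → Bool) → (∀ x → P x ≡ Q x) → count P ≡ count Q
    count-cong P Q e = sumL-cong (elems E) (λ x → cong 𝟙 (e x))

    count-split : (P Q : A → Bool) → count P ≡ count (λ x → P x ∧ Q x) + count (λ x → P x ∧ not (Q x))
    count-split P Q = trans (sumL-cong (elems E) pointwise) (sumL-+ _ _ (elems E))
      where
      pointwise : ∀ x → 𝟙 (P x) ≡ 𝟙 (P x ∧ Q x) + 𝟙 (P x ∧ not (Q x))
      pointwise x with P x | Q x
      ... | true  | true  = refl
      ... | true  | false = refl
      ... | false | _     = refl

    count≡total⇒all : (P : A → Bool) → count P ≡ total → ∀ a → P a ≡ true
    count≡total⇒all P eq a with P a in Pa
    ... | true  = refl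
    ... | false = ⊥-elim (1≰0 (subst (_≤ 0) (trans (sumL-δ* missing a) missing-a) bound))
      where
      missing : A → ℕ
      missing x = 𝟙 (not (P x))
      missing-a : missing a ≡ 1
      missing-a = cong (λ b → 𝟙 (not b)) Pa
      complement : ∀ x → 𝟙 (P x) + missing x ≡ 1
      complement x with P x
      ... | true  = refl
      ... | false = refl
      no-missing : sumL missing (elems E) ≡ 0
      no-missing = +-cancelˡ-≡ (count P) (sumL missing (elems E)) 0 (trans (sym (sumL-+ (λ x → 𝟙 (P x)) missing (elems E)))
        (trans (sumL-cong (elems E) complement) (trans (sym eq) (sym (+-identityʳ _)))))
      bound : sumL (λ x → δ (deq E x a) * missing x) (elems E) ≤ 0
      bound = subst (sumL (λ x → δ (deq E x a) * missing x) (elems E) ≤_) no-missing (sumL-mono-≤ (elems E) λ x → ≤-trans (*-monoˡ-≤ (missing x) (δ≤1 (deq E x a))) (≤-reflexive (*-identityˡ (missing x))))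
        where
        δ≤1 : ∀ {p} {P : Set p} (d : Dec P) → δ d ≤ 1
        δ≤1 (yes _) = s≤s z≤n
        δ≤1 (no _)  = z≤n
      1≰0 : ¬ (1 ≤ 0)
      1≰0 ()

  module _ {A B : Set} (EA : Enum A) (EB : Enum B) where

    count-bijection : (P : A → Bool) (Q : B → Bool) (f : A → B) (g : B → A) →
      (∀ x → P x ≡ true → Q (f x) ≡ true) →
      (∀ y → Q y ≡ true → P (g y) ≡ true) →
      (∀ x → P x ≡ true → g (f x) ≡ x) →
      (∀ y → Q y ≡ true → f (g y) ≡ y) →
      count EA P ≡ count EB Q
    count-bijection P Q f g PQ QP gf fg = begin
        sumL (λ x → 𝟙 (P x)) (elems EA)                    ≡⟨ sumL-cong (elems EA) rowSum ⟩
        sumL (λ x → sumL (M x) (elems EB)) (elems EA)       ≡⟨ sumL-comm M (elems EA) (elems EB) ⟩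
        sumL (λ y → sumL (λ x → M x y) (elems EA)) (elems EB) ≡⟨ sumL-cong (elems EB) columnSum ⟩
        sumL (λ y → 𝟙 (Q y)) (elems EB)                    ∎
      where
      open ≡-Reasoning
      M : A → B → ℕ
      M x y = 𝟙 (P x) * δ (deq EB y (f x))
      rowSum : ∀ x → 𝟙 (P x) ≡ sumL (M x) (elems EB)
      rowSum x = sym (trans (sumL-*ˡ (𝟙 (P x)) (λ y → δ (deq EB y (f x))) (elems EB))
                   (trans (cong (𝟙 (P x) *_) (once EB (f x))) (*-identityʳ _)))
      columnSum : ∀ y → sumL (λ x → M x y) (elems EA) ≡ 𝟙 (Q y)
      columnSum y with Q y in Qy
      ... | true = sumL-δ EA (λ x → M x y) (g y) entry
        where
        entry : ∀ x → M x y ≡ δ (deq EA x (g y))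
        entry x with P x in Px | deq EB y (f x) | deq EA x (g y)
        ... | true  | yes e | yes _ = refl
        ... | true  | yes e | no ne = ⊥-elim (ne (trans (sym (gf x Px)) (cong g (sym e))))
        ... | true  | no ne | yes e = ⊥-elim (ne (trans (sym (fg y Qy)) (cong f (sym e))))
        ... | true  | no _  | no _  = refl
        ... | false | _     | yes e with () ← trans (sym Px) (trans (cong P e) (QP y Qy))
        ... | false | yes _ | no _  = refl
        ... | false | no _  | no _  = refl
      ... | false = trans (sumL-cong (elems EA) entry) (sumL-zero (elems EA))
        where
        entry : ∀ x → M x y ≡ 0
        entry x with P x in Px | deq EB y (f x)
        ... | true  | yes e with () ← trans (sym Qy) (trans (cong Q e) (PQ x Px))
        ... | true  | no _  = refl
        ... | false | _     = refl

  sumL-tabulate : ∀ {a} {A : Set a} n (f : Fin n → A) (h : A → ℕ) →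
    sumL h (tabulate f) ≡ sumL (λ i → h (f i)) (allFin n)
  sumL-tabulate zero    f h = refl
  sumL-tabulate (suc n) f h = cong (h (f fz) +_)
    (trans (sumL-tabulate n (λ i → f (fs i)) h) (sym (sumL-tabulate n fs (λ i → h (f i)))))

  sumL-allFin-suc : ∀ n (h : Fin (suc n) → ℕ) → sumL h (allFin (suc n)) ≡ h fz + sumL (λ i → h (fs i)) (allFin n)
  sumL-allFin-suc n h = cong (h fz +_) (sumL-tabulate n fs h)

  finEnum : ∀ n → Enum (Fin n)
  finEnum n = record { elems = allFin n ; deq = _≟F_ ; once = occurs-once n }
    where
    δ-suc : ∀ {n} (x a : Fin n) → δ (fs x ≟F fs a) ≡ δ (x ≟F a)
    δ-suc x a with x ≟F a
    ... | yes refl = refl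
    ... | no ne with fs x ≟F fs a
    ...   | yes e = ⊥-elim (ne (fs-injective e))
    ...   | no _  = refl
    occurs-once : ∀ n (a : Fin n) → sumL (λ x → δ (x ≟F a)) (allFin n) ≡ 1
    occurs-once (suc n) fz = trans (sumL-allFin-suc n (λ x → δ (x ≟F fz))) (cong suc (sumL-zero (allFin n)))
    occurs-once (suc n) (fs a) = trans (sumL-allFin-suc n (λ x → δ (x ≟F fs a)))
      (trans (sumL-cong (allFin n) (λ x → δ-suc x a)) (occurs-once n a))

  total-finEnum : ∀ n → total (finEnum n) ≡ n
  total-finEnum zero    = refl
  total-finEnum (suc n) = trans (sumL-allFin-suc n (λ _ → 1)) (cong suc (total-finEnum n))

  pairs : ∀ {A B : Set} → List A → List B → List (A × B)
  pairs xs ys = concatMap (λ x → map (x ,_) ys) xs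

  sumL-pairs : ∀ {A B : Set} (xs : List A) (ys : List B) (h : A × B → ℕ) →
    sumL h (pairs xs ys) ≡ sumL (λ x → sumL (λ y → h (x , y)) ys) xs
  sumL-pairs xs ys h = trans (sumL-concatMap h (λ x → map (x ,_) ys) xs) (sumL-cong xs (λ x → sumL-map h (x ,_) ys))

  module _ {A B : Set} (EA : Enum A) (EB : Enum B) where

    ×-enum : Enum (A × B)
    ×-enum = record { elems = pairs (elems EA) (elems EB) ; deq = _≟×_ ; once = occurs-once }
      where
      _≟×_ : DecidableEquality (A × B)
      (a , b) ≟× (a' , b') with deq EA a a' | deq EB b b'
      ... | yes refl | yes refl = yes refl
      ... | no ne    | _        = no (λ { refl → ne refl })
      ... | yes _    | no ne    = no (λ { refl → ne refl })
      δ-× : ∀ a b a' b' → δ ((a , b) ≟× (a' , b')) ≡ δ (deq EA a a') * δ (deq EB b b')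
      δ-× a b a' b' with deq EA a a' | deq EB b b'
      ... | yes refl | yes refl = refl
      ... | no ne    | _        = refl
      ... | yes refl | no ne    = refl
      occurs-once : ∀ p → sumL (λ x → δ (x ≟× p)) (pairs (elems EA) (elems EB)) ≡ 1
      occurs-once (a' , b') = trans (sumL-pairs (elems EA) (elems EB) _)
        (trans (sumL-cong (elems EA) (λ a → trans (sumL-cong (elems EB) (λ b → δ-× a b a' b'))
                 (trans (sumL-*ˡ (δ (deq EA a a')) (λ y → δ (deq EB y b')) (elems EB))
                   (trans (cong (δ (deq EA a a') *_) (once EB b')) (*-identityʳ _)))))
          (once EA a'))

    count-× : (P : A → Bool) (Q : B → Bool) →
      count ×-enum (λ p → P (proj₁ p) ∧ Q (proj₂ p)) ≡ count EA P * count EB Q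
    count-× P Q = trans (sumL-pairs (elems EA) (elems EB) _)
      (trans (sumL-cong (elems EA) (λ a → trans (sumL-cong (elems EB) (λ b → 𝟙-∧ (P a) (Q b)))
                                                  (sumL-*ˡ (𝟙 (P a)) (λ b → 𝟙 (Q b)) (elems EB))))
             (sumL-*ʳ _ (λ a → 𝟙 (P a)) (elems EA)))
      where
      𝟙-∧ : ∀ a b → 𝟙 (a ∧ b) ≡ 𝟙 a * 𝟙 b
      𝟙-∧ true  b = sym (+-identityʳ (𝟙 b))
      𝟙-∧ false b = refl

  vecs : ∀ {A : Set} → List A → (n : ℕ) → List (Vec A n)
  vecs xs zero    = []v ∷ []
  vecs xs (suc n) = concatMap (λ x → map (x ∷v_) (vecs xs n)) xs

  sumL-vecs : ∀ {A : Set} (xs : List A) n (h : Vec A (suc n) → ℕ) →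
    sumL h (vecs xs (suc n)) ≡ sumL (λ x → sumL (λ w → h (x ∷v w)) (vecs xs n)) xs
  sumL-vecs xs n h = trans (sumL-concatMap h (λ x → map (x ∷v_) (vecs xs n)) xs)
                           (sumL-cong xs (λ x → sumL-map h (x ∷v_) (vecs xs n)))

  module _ {A : Set} (E : Enum A) where

    vecEnum : ∀ n → Enum (Vec A n)
    vecEnum n = record { elems = vecs (elems E) n ; deq = _≟V_ ; once = occurs-once n }
      where
      _≟V_ : ∀ {n} → DecidableEquality (Vec A n)
      []v ≟V []v = yes refl
      (a ∷v w) ≟V (a' ∷v w') with deq E a a' | w ≟V w'
      ... | yes refl | yes refl = yes refl
      ... | no ne    | _        = no (λ { refl → ne refl })
      ... | yes _    | no ne    = no (λ { refl → ne refl })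
      δ-∷ : ∀ {n} a (w : Vec A n) a' w' → δ ((a ∷v w) ≟V (a' ∷v w')) ≡ δ (deq E a a') * δ (w ≟V w')
      δ-∷ a w a' w' with deq E a a' | w ≟V w'
      ... | yes refl | yes refl = refl
      ... | no ne    | _        = refl
      ... | yes refl | no ne    = refl
      occurs-once : ∀ n (p : Vec A n) → sumL (λ x → δ (x ≟V p)) (vecs (elems E) n) ≡ 1
      occurs-once zero    []v         = refl
      occurs-once (suc n) (a' ∷v w') = trans (sumL-vecs (elems E) n _)
        (trans (sumL-cong (elems E) (λ a → trans (sumL-cong (vecs (elems E) n) (λ w → δ-∷ a w a' w'))
                 (trans (sumL-*ˡ (δ (deq E a a')) (λ x → δ (x ≟V w')) (vecs (elems E) n))
                   (trans (cong (δ (deq E a a') *_) (occurs-once n w')) (*-identityʳ _)))))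
          (once E a'))

    total-vecEnum : ∀ n → total (vecEnum n) ≡ total E ^ n
    total-vecEnum zero    = refl
    total-vecEnum (suc n) = trans (sumL-vecs (elems E) n (λ _ → 1))
      (trans (sumL-cong (elems E) (λ a → trans (total-vecEnum n) (sym (*-identityˡ _)))) (sumL-*ʳ _ (λ _ → 1) (elems E)))

  sumL-congAll : ∀ {a p} {A : Set a} {P : A → Set p} {f g : A → ℕ} {xs : List A} →
    All P xs → (∀ x → P x → f x ≡ g x) → sumL f xs ≡ sumL g xs
  sumL-congAll [] e = refl
  sumL-congAll {xs = x ∷ xs} (px ∷ pxs) e = cong₂ _+_ (e x px) (sumL-congAll pxs e)

  bool-ext : ∀ {a b : Bool} → (a ≡ true → b ≡ true) → (b ≡ true → a ≡ true) → a ≡ b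
  bool-ext {true}  {true}  _ _ = refl
  bool-ext {true}  {false} f _ = sym (f refl)
  bool-ext {false} {true}  _ g = g refl
  bool-ext {false} {false} _ _ = refl

  ∧≡true⁻ : ∀ {a b : Bool} → a ∧ b ≡ true → (a ≡ true) × (b ≡ true)
  ∧≡true⁻ {true} {true} _ = refl , refl

  ∧≡true⁺ : ∀ {a b : Bool} → a ≡ true → b ≡ true → a ∧ b ≡ true
  ∧≡true⁺ refl refl = refl

  not≡true⁻ : ∀ {a : Bool} → not a ≡ true → a ≡ false
  not≡true⁻ {false} _ = refl

  not≡true⁺ : ∀ {a : Bool} → a ≡ false → not a ≡ true
  not≡true⁺ refl = refl

  does-true⁻ : ∀ {a} {A : Set a} (d : Dec A) → does d ≡ true → A
  does-true⁻ (yes a) _ = a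

  search : ∀ {A : Set} (p : A → Bool) (xs : List A) → (∃ λ a → p a ≡ true) ⊎ All (λ x → p x ≡ false) xs
  search p [] = inj₂ []
  search p (x ∷ xs) with p x in e
  ... | true  = inj₁ (x , e)
  ... | false with search p xs
  ...   | inj₁ r = inj₁ r
  ...   | inj₂ h = inj₂ (e ∷ h)

  found : ∀ {a b} {A : Set a} {B : Set b} → A ⊎ B → Bool
  found (inj₁ _) = true
  found (inj₂ _) = false

  module _ {A : Set} (E : Enum A) where

    all-false⇒¬true : (p : A → Bool) → All (λ x → p x ≡ false) (elems E) → ∀ a → p a ≡ true → ⊥
    all-false⇒¬true p h a pa = 1≢0 (trans (sym (once E a)) (trans (sumL-congAll h vanishes) (sumL-zero (elems E))))
      where
      1≢0 : ¬ 1 ≡ 0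
      1≢0 ()
      vanishes : ∀ x → p x ≡ false → δ (deq E x a) ≡ 0
      vanishes x px with deq E x a
      ... | yes refl with () ← trans (sym px) pa
      ... | no _ = refl

    search-found : (p : A → Bool) → ∀ a → p a ≡ true → found (search p (elems E)) ≡ true
    search-found p a pa with search p (elems E)
    ... | inj₁ _ = refl
    ... | inj₂ h = ⊥-elim (all-false⇒¬true p h a pa)

module Subsets {A : Set} (_≟_ : DecidableEquality A) where

  open import Defs using (choose)
  open Counting
  open import Data.Nat using (ℕ; zero; suc; _+_; _*_)
  open import Data.Nat.Properties using (+-identityʳ; *-zeroʳ; *-distribˡ-+; *-distribʳ-+)
  open import Data.Bool using (Bool; true; false; if_then_else_; not)
  open import Data.List using (List; []; _∷_; map; _++_; tabulate)
  open import Data.Fin using (Fin) renaming (zero to fz; suc to fs)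
  open import Data.Fin.Properties using () renaming (suc-injective to fs-injective)
  open import Function using (case_of_)
  open import Data.List.Relation.Unary.All as All using (All; []; _∷_)
  open import Data.List.Relation.Unary.All.Properties using (map⁺; ++⁺)
  open import Data.Vec using (Vec; toList) renaming (_∷_ to _∷v_)
  open import Data.Product using (_×_; _,_)
  open import Data.Empty using (⊥-elim)
  open import Relation.Nullary using (¬_; yes; no; does)
  open import Relation.Binary.PropositionalEquality

  mem : A → List A → Bool
  mem x []       = false
  mem x (y ∷ ys) = if does (x ≟ y) then true else mem x ys

  data Nodup : List A → Set where
    []  : Nodup []
    _∷_ : ∀ {x xs} → mem x xs ≡ false → Nodup xs → Nodup (x ∷ xs)

  ChosenFrom : List A → List A → Set
  ChosenFrom L t = Nodup t × (∀ z → mem z t ≡ true → mem z L ≡ true)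

  mem-here : ∀ x ys → mem x (x ∷ ys) ≡ true
  mem-here x ys with x ≟ x
  ... | yes _ = refl
  ... | no ne = ⊥-elim (ne refl)

  mem-there : ∀ x y ys → ¬ x ≡ y → mem x (y ∷ ys) ≡ mem x ys
  mem-there x y ys ne with x ≟ y
  ... | yes e = ⊥-elim (ne e)
  ... | no _  = refl

  mem-there⁺ : ∀ x y {ys} → mem x ys ≡ true → mem x (y ∷ ys) ≡ true
  mem-there⁺ x y x∈ys with x ≟ y
  ... | yes _ = refl
  ... | no _  = x∈ys

  mem-∷⁺ : ∀ x y {s ys} → (mem x s ≡ true → mem x ys ≡ true) → mem x (y ∷ s) ≡ true → mem x (y ∷ ys) ≡ true
  mem-∷⁺ x y s⊆ys with x ≟ y
  ... | yes _ = λ _ → refl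
  ... | no _  = s⊆ys

  choose-chosenFrom : ∀ L → Nodup L → ∀ m → All (λ t → ChosenFrom L (toList t)) (choose m L)
  choose-chosenFrom L ndL zero = ([] , (λ z ())) ∷ []
  choose-chosenFrom [] ndL (suc m) = []
  choose-chosenFrom (y ∷ ys) (y∉ys ∷ ndys) (suc m) =
    ++⁺ (map⁺ (All.map with-y (choose-chosenFrom ys ndys m))) (All.map without-y (choose-chosenFrom ys ndys (suc m)))
    where
    with-y : ∀ {t : Vec A m} → ChosenFrom ys (toList t) → ChosenFrom (y ∷ ys) (toList (y ∷v t))
    with-y {t} (ndt , t⊆ys) = y∉t ∷ ndt , λ z → mem-∷⁺ z y {toList t} {ys} (t⊆ys z)
      where
      y∉t : mem y (toList t) ≡ false
      y∉t with mem y (toList t) in e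
      ... | true  with () ← trans (sym (t⊆ys y e)) y∉ys
      ... | false = refl
    without-y : ∀ {t : Vec A (suc m)} → ChosenFrom ys (toList t) → ChosenFrom (y ∷ ys) (toList t)
    without-y {t} (ndt , t⊆ys) = ndt , λ z z∈t → mem-there⁺ z y {ys} (t⊆ys z z∈t)

  sumL-choose-∷ : ∀ k y ys (F : Vec A (suc k) → ℕ) →
    sumL F (choose (suc k) (y ∷ ys)) ≡ sumL (λ t → F (y ∷v t)) (choose k ys) + sumL F (choose (suc k) ys)
  sumL-choose-∷ k y ys F =
    trans (sumL-++ F (map (y ∷v_) (choose k ys)) _) (cong (_+ sumL F (choose (suc k) ys)) (sumL-map F (y ∷v_) (choose k ys)))

  module _ (L : List A) (ndL : Nodup L) (x : A) (x∉L : mem x L ≡ false) where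

    sumL-choose-∌ : ∀ k (f : List A → ℕ) → sumL (λ t → 𝟙 (mem x (toList t)) * f (toList t)) (choose k L) ≡ 0
    sumL-choose-∌ k f = trans (sumL-congAll (choose-chosenFrom L ndL k) vanishes) (sumL-zero (choose k L))
      where
      vanishes : ∀ t → ChosenFrom L (toList t) → 𝟙 (mem x (toList t)) * f (toList t) ≡ 0
      vanishes t (_ , t⊆L) with mem x (toList t) in e
      ... | true  with () ← trans (sym (t⊆L x e)) x∉L
      ... | false = refl

    sumL-choose-∌′ : ∀ k (f : List A → ℕ) →
      sumL (λ t → 𝟙 (not (mem x (toList t))) * f (toList t)) (choose k L) ≡ sumL (λ t → f (toList t)) (choose k L)
    sumL-choose-∌′ k f = sumL-congAll (choose-chosenFrom L ndL k) unit
      where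
      unit : ∀ t → ChosenFrom L (toList t) → 𝟙 (not (mem x (toList t))) * f (toList t) ≡ f (toList t)
      unit t (_ , t⊆L) with mem x (toList t) in e
      ... | true  with () ← trans (sym (t⊆L x e)) x∉L
      ... | false = +-identityʳ (f (toList t))

  sumL-choose-fresh : ∀ x ys → Nodup ys → mem x ys ≡ false → ∀ m (ψ : List A → ℕ) →
    sumL (λ t → 𝟙 (not (mem x (toList t))) * ψ (toList t)) (choose m (x ∷ ys)) ≡ sumL (λ t → ψ (toList t)) (choose m ys)
  sumL-choose-fresh x ys ndys x∉ys zero ψ = cong (_+ 0) (+-identityʳ (ψ []))
  sumL-choose-fresh x ys ndys x∉ys (suc k) ψ =
    trans (sumL-choose-∷ k x ys _)
      (cong₂ _+_ (trans (sumL-cong (choose k ys) (λ t → cong (λ b → 𝟙 (not b) * ψ (x ∷ toList t)) (mem-here x (toList t))))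
                        (sumL-zero (choose k ys)))
                 (sumL-choose-∌′ ys ndys x x∉ys (suc k) ψ))

  SwapInvariant : (List A → ℕ) → Set
  SwapInvariant φ = ∀ u x y s → φ (u ++ x ∷ y ∷ s) ≡ φ (u ++ y ∷ x ∷ s)

  -- An (m+1)-subset containing x is x added to an m-subset avoiding x.
  sumL-choose-∋ : ∀ L → Nodup L → ∀ m (φ : List A → ℕ) → SwapInvariant φ → ∀ x → mem x L ≡ true →
    sumL (λ t → 𝟙 (mem x (toList t)) * φ (toList t)) (choose (suc m) L)
      ≡ sumL (λ t → 𝟙 (not (mem x (toList t))) * φ (x ∷ toList t)) (choose m L)
  sumL-choose-∋ (y ∷ ys) (y∉ys ∷ ndys) m φ swap x x∈L with x ≟ y
  ... | yes refl = begin
      sumL F (choose (suc m) (x ∷ ys))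
    ≡⟨ sumL-choose-∷ m x ys F ⟩
      sumL (λ t → F (x ∷v t)) (choose m ys) + sumL F (choose (suc m) ys)
    ≡⟨ cong₂ _+_ (sumL-cong (choose m ys) (λ t → trans (cong (λ b → 𝟙 b * φ (x ∷ toList t)) (mem-here x (toList t))) (+-identityʳ _)))
                 (sumL-choose-∌ ys ndys x y∉ys (suc m) φ) ⟩
      sumL (λ t → φ (x ∷ toList t)) (choose m ys) + 0
    ≡⟨ +-identityʳ _ ⟩
      sumL (λ t → φ (x ∷ toList t)) (choose m ys)
    ≡⟨ sym (sumL-choose-fresh x ys ndys y∉ys m (λ t → φ (x ∷ t))) ⟩
      sumL (λ t → 𝟙 (not (mem x (toList t))) * φ (x ∷ toList t)) (choose m (x ∷ ys))
    ∎
    where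
    open ≡-Reasoning
    F : Vec A (suc m) → ℕ
    F t = 𝟙 (mem x (toList t)) * φ (toList t)
  sumL-choose-∋ (y ∷ ys) (y∉ys ∷ ndys) zero φ swap x x∈ys | no x≢y =
    trans (sumL-choose-∷ 0 y ys F)
      (trans (cong (λ b → 𝟙 b * φ (y ∷ []) + 0 + sumL F (choose 1 ys)) (mem-there x y [] x≢y))
             (sumL-choose-∋ ys ndys 0 φ swap x x∈ys))
    where
    F : Vec A 1 → ℕ
    F t = 𝟙 (mem x (toList t)) * φ (toList t)
  sumL-choose-∋ (y ∷ ys) (y∉ys ∷ ndys) (suc k) φ swap x x∈ys | no x≢y = begin
      sumL F (choose (2 + k) (y ∷ ys))
    ≡⟨ sumL-choose-∷ (suc k) y ys F ⟩
      sumL (λ t → F (y ∷v t)) (choose (suc k) ys) + sumL F (choose (2 + k) ys)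
    ≡⟨ cong₂ _+_ through-y (sumL-choose-∋ ys ndys (suc k) φ swap x x∈ys) ⟩
      sumL (λ t → G (y ∷v t)) (choose k ys) + sumL G (choose (suc k) ys)
    ≡⟨ sym (sumL-choose-∷ k y ys G) ⟩
      sumL G (choose (suc k) (y ∷ ys))
    ∎
    where
    open ≡-Reasoning
    F : Vec A (2 + k) → ℕ
    F t = 𝟙 (mem x (toList t)) * φ (toList t)
    G : Vec A (suc k) → ℕ
    G t = 𝟙 (not (mem x (toList t))) * φ (x ∷ toList t)
    through-y : sumL (λ t → F (y ∷v t)) (choose (suc k) ys) ≡ sumL (λ t → G (y ∷v t)) (choose k ys)
    through-y = begin
        sumL (λ t → F (y ∷v t)) (choose (suc k) ys)
      ≡⟨ sumL-cong (choose (suc k) ys) (λ t → cong (λ b → 𝟙 b * φ (y ∷ toList t)) (mem-there x y (toList t) x≢y)) ⟩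
        sumL (λ t → 𝟙 (mem x (toList t)) * φ (y ∷ toList t)) (choose (suc k) ys)
      ≡⟨ sumL-choose-∋ ys ndys k (λ t → φ (y ∷ t)) (λ u → swap (y ∷ u)) x x∈ys ⟩
        sumL (λ t → 𝟙 (not (mem x (toList t))) * φ (y ∷ x ∷ toList t)) (choose k ys)
      ≡⟨ sumL-cong (choose k ys) (λ t → cong₂ (λ b w → 𝟙 (not b) * w) (sym (mem-there x y (toList t) x≢y)) (swap [] y x (toList t))) ⟩
        sumL (λ t → G (y ∷v t)) (choose k ys)
      ∎

  common : List A → List A → ℕ
  common L t = sumL (λ x → 𝟙 (mem x t)) L

  common-∷-∉ : ∀ y ys s → mem y ys ≡ false → common ys (y ∷ s) ≡ common ys s
  common-∷-∉ y []       s y∉ = refl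
  common-∷-∉ y (z ∷ zs) s y∉ with z ≟ y
  ... | yes refl with () ← trans (sym (mem-here z zs)) y∉
  ... | no z≢y = cong (𝟙 (mem z s) +_) (common-∷-∉ y zs s (trans (sym (mem-there y z zs (λ e → z≢y (sym e)))) y∉))

  sumL-choose-common : ∀ L → Nodup L → ∀ m (ψ : List A → ℕ) →
    sumL (λ t → common L (toList t) * ψ (toList t)) (choose m L) ≡ m * sumL (λ t → ψ (toList t)) (choose m L)
  sumL-choose-common L ndL zero ψ = cong (λ w → w * ψ [] + 0) (sumL-zero L)
  sumL-choose-common [] ndL (suc m) ψ = sym (*-zeroʳ m)
  sumL-choose-common (y ∷ ys) (y∉ys ∷ ndys) (suc k) ψ = begin
      sumL F (choose (suc k) (y ∷ ys))
    ≡⟨ sumL-choose-∷ k y ys F ⟩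
      sumL (λ t → F (y ∷v t)) (choose k ys) + sumL F (choose (suc k) ys)
    ≡⟨ cong₂ _+_ through-y avoiding-y ⟩
      suc k * sumL (λ t → ψ (y ∷ toList t)) (choose k ys) + suc k * sumL H (choose (suc k) ys)
    ≡⟨ sym (*-distribˡ-+ (suc k) (sumL (λ t → H (y ∷v t)) (choose k ys)) _) ⟩
      suc k * (sumL (λ t → H (y ∷v t)) (choose k ys) + sumL H (choose (suc k) ys))
    ≡⟨ cong (suc k *_) (sym (sumL-choose-∷ k y ys H)) ⟩
      suc k * sumL H (choose (suc k) (y ∷ ys))
    ∎
    where
    open ≡-Reasoning
    F H : Vec A (suc k) → ℕ
    F t = common (y ∷ ys) (toList t) * ψ (toList t)
    H t = ψ (toList t)
    through-y : sumL (λ t → F (y ∷v t)) (choose k ys) ≡ suc k * sumL (λ t → ψ (y ∷ toList t)) (choose k ys)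
    through-y = begin
        sumL (λ t → F (y ∷v t)) (choose k ys)
      ≡⟨ sumL-cong (choose k ys) (λ t → cong (_* ψ (y ∷ toList t))
           (cong₂ _+_ (cong 𝟙 (mem-here y (toList t))) (common-∷-∉ y ys (toList t) y∉ys))) ⟩
        sumL (λ t → ψ (y ∷ toList t) + common ys (toList t) * ψ (y ∷ toList t)) (choose k ys)
      ≡⟨ sumL-+ _ _ (choose k ys) ⟩
        sumL (λ t → ψ (y ∷ toList t)) (choose k ys) + sumL (λ t → common ys (toList t) * ψ (y ∷ toList t)) (choose k ys)
      ≡⟨ cong (sumL (λ t → ψ (y ∷ toList t)) (choose k ys) +_) (sumL-choose-common ys ndys k (λ t → ψ (y ∷ t))) ⟩
        suc k * sumL (λ t → ψ (y ∷ toList t)) (choose k ys)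
      ∎
    avoiding-y : sumL F (choose (suc k) ys) ≡ suc k * sumL H (choose (suc k) ys)
    avoiding-y = begin
        sumL F (choose (suc k) ys)
      ≡⟨ sumL-cong (choose (suc k) ys) (λ t → *-distribʳ-+ (ψ (toList t)) (𝟙 (mem y (toList t))) (common ys (toList t))) ⟩
        sumL (λ t → 𝟙 (mem y (toList t)) * ψ (toList t) + common ys (toList t) * ψ (toList t)) (choose (suc k) ys)
      ≡⟨ sumL-+ _ _ (choose (suc k) ys) ⟩
        sumL (λ t → 𝟙 (mem y (toList t)) * ψ (toList t)) (choose (suc k) ys) + sumL (λ t → common ys (toList t) * ψ (toList t)) (choose (suc k) ys)
      ≡⟨ cong₂ _+_ (sumL-choose-∌ ys ndys y y∉ys (suc k) ψ) (sumL-choose-common ys ndys (suc k) ψ) ⟩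
        suc k * sumL H (choose (suc k) ys)
      ∎

  -- Every m-subset is counted once for each of its m elements.
  double-counting : ∀ L → Nodup L → ∀ m (ψ : List A → ℕ) →
    sumL (λ x → sumL (λ t → 𝟙 (mem x (toList t)) * ψ (toList t)) (choose m L)) L ≡ m * sumL (λ t → ψ (toList t)) (choose m L)
  double-counting L ndL m ψ = trans (sumL-comm _ L (choose m L))
    (trans (sumL-cong (choose m L) (λ t → sumL-*ʳ (ψ (toList t)) (λ x → 𝟙 (mem x (toList t))) L)) (sumL-choose-common L ndL m ψ))

  mem-swap : ∀ z u x y s → mem z (u ++ x ∷ y ∷ s) ≡ mem z (u ++ y ∷ x ∷ s)
  mem-swap z [] x y s with z ≟ x | z ≟ y
  ... | yes _ | yes _ = refl
  ... | yes _ | no _  = refl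
  ... | no _  | yes _ = refl
  ... | no _  | no _  = refl
  mem-swap z (w ∷ u) x y s with z ≟ w
  ... | yes _ = refl
  ... | no _  = mem-swap z u x y s

  mem-tabulate : ∀ {m} (f : Fin m → A) k → mem (f k) (tabulate f) ≡ true
  mem-tabulate f fz     = mem-here (f fz) (tabulate (λ k → f (fs k)))
  mem-tabulate f (fs k) = mem-there⁺ (f (fs k)) (f fz) {tabulate (λ k → f (fs k))} (mem-tabulate (λ k → f (fs k)) k)

  mem-tabulate-∉ : ∀ {m} (f : Fin m → A) x → (∀ k → ¬ x ≡ f k) → mem x (tabulate f) ≡ false
  mem-tabulate-∉ {zero}  f x x∉ = refl
  mem-tabulate-∉ {suc m} f x x∉ =
    trans (mem-there x (f fz) (tabulate (λ k → f (fs k))) (x∉ fz)) (mem-tabulate-∉ (λ k → f (fs k)) x (λ k → x∉ (fs k)))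

  tabulate-Nodup : ∀ {m} (f : Fin m → A) → (∀ a b → f a ≡ f b → a ≡ b) → Nodup (tabulate f)
  tabulate-Nodup {zero}  f inj = []
  tabulate-Nodup {suc m} f inj =
    mem-tabulate-∉ (λ k → f (fs k)) (f fz) (λ k e → case inj fz (fs k) e of λ ())
    ∷ tabulate-Nodup (λ k → f (fs k)) (λ a b e → fs-injective (inj (fs a) (fs b) e))

module RingSums {c ℓ} (R : CommutativeRing c ℓ) where

  open CommutativeRing R
  open RingOps R
  open Counting using (sumL; sumL-allFin-suc)
  open import Data.Nat as ℕ using (ℕ; zero; suc)
  open import Data.Fin using (Fin) renaming (zero to fz; suc to fs)
  open import Data.Fin.Properties using () renaming (_≟_ to _≟F_; suc-injective to fs-injective)
  open import Data.Bool using (if_then_else_)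
  open import Data.List using (allFin)
  open import Data.Empty using (⊥-elim)
  open import Relation.Nullary using (yes; no; does)
  open import Relation.Binary.PropositionalEquality as ≡ using (_≡_)
  open import Algebra.Properties.Monoid.Sum +-monoid using (sum; sum-cong-≋; sum-replicate-zero)
  open import Algebra.Properties.CommutativeMonoid.Sum +-commutativeMonoid using (∑-distrib-+)
  open import Algebra.Properties.Semiring.Sum semiring using (*-distribˡ-sum)
  open import Algebra.Properties.Monoid.Mult +-monoid using (_×_; ×-homo-+)
  open import Algebra.Properties.Semiring.Mult semiring using (×1-homo-*)

  ∑≡sum : ∀ {m} (f : Fin m → Carrier) → ∑ f ≡ sum f
  ∑≡sum {zero}  f = ≡.refl
  ∑≡sum {suc m} f = ≡.cong (f fz +_) (∑≡sum (λ k → f (fs k)))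

  ∑-cong : ∀ {m} {f g : Fin m → Carrier} → (∀ k → f k ≈ g k) → ∑ f ≈ ∑ g
  ∑-cong {f = f} {g} f≈g = trans (reflexive (∑≡sum f)) (trans (sum-cong-≋ f≈g) (reflexive (≡.sym (∑≡sum g))))

  ∑-zero : ∀ m → ∑ {m} (λ _ → 0#) ≈ 0#
  ∑-zero m = trans (reflexive (∑≡sum {m} (λ _ → 0#))) (sum-replicate-zero m)

  ∑-+ : ∀ {m} (f g : Fin m → Carrier) → ∑ (λ k → f k + g k) ≈ ∑ f + ∑ g
  ∑-+ f g = trans (reflexive (∑≡sum (λ k → f k + g k)))
    (trans (∑-distrib-+ f g) (reflexive (≡.sym (≡.cong₂ _+_ (∑≡sum f) (∑≡sum g)))))

  ∑-*ˡ : ∀ {m} (a : Carrier) (f : Fin m → Carrier) → ∑ (λ k → a * f k) ≈ a * ∑ f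
  ∑-*ˡ a f = trans (reflexive (∑≡sum (λ k → a * f k))) (trans (sym (*-distribˡ-sum a f)) (reflexive (≡.cong (a *_) (≡.sym (∑≡sum f)))))

  stdBasis : ∀ {m} → Fin m → Fin m → Carrier
  stdBasis k i = if does (i ≟F k) then 1# else 0#

  ∑-stdBasis : ∀ {m} (f : Fin m → Carrier) (k : Fin m) → ∑ (λ i → f i * stdBasis k i) ≈ f k
  ∑-stdBasis {suc m} f fz =
    trans (+-cong (*-identityʳ (f fz)) (trans (∑-cong (λ i → zeroʳ (f (fs i)))) (∑-zero m))) (+-identityʳ _)
  ∑-stdBasis {suc m} f (fs k) =
    trans (+-cong (zeroʳ (f fz)) (∑-cong shift)) (trans (+-identityˡ _) (∑-stdBasis (λ i → f (fs i)) k))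
    where
    shift : ∀ i → f (fs i) * stdBasis (fs k) (fs i) ≈ f (fs i) * stdBasis k i
    shift i with i ≟F k
    ... | yes ≡.refl = refl
    ... | no i≢k with fs i ≟F fs k
    ...   | yes e = ⊥-elim (i≢k (fs-injective e))
    ...   | no _  = refl

  fromℕ≈×1 : ∀ m → fromℕ m ≈ m × 1#
  fromℕ≈×1 zero    = refl
  fromℕ≈×1 (suc m) = +-cong refl (fromℕ≈×1 m)

  fromℕ-+ : ∀ a b → fromℕ (a ℕ.+ b) ≈ fromℕ a + fromℕ b
  fromℕ-+ a b = trans (fromℕ≈×1 (a ℕ.+ b))
    (trans (×-homo-+ 1# a b) (sym (+-cong (fromℕ≈×1 a) (fromℕ≈×1 b))))

  fromℕ-* : ∀ a b → fromℕ (a ℕ.* b) ≈ fromℕ a * fromℕ b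
  fromℕ-* a b = trans (fromℕ≈×1 (a ℕ.* b))
    (trans (×1-homo-* a b) (sym (*-cong (fromℕ≈×1 a) (fromℕ≈×1 b))))

  ∑-fromℕ : ∀ {m} (f : Fin m → ℕ) → ∑ (λ k → fromℕ (f k)) ≈ fromℕ (sumL f (allFin m))
  ∑-fromℕ {zero}  f = refl
  ∑-fromℕ {suc m} f = trans (+-cong refl (∑-fromℕ (λ k → f (fs k))))
    (trans (sym (fromℕ-+ (f fz) _)) (reflexive (≡.cong fromℕ (≡.sym (sumL-allFin-suc m f)))))

module QAnalogues where

  open import Data.Nat using (ℕ; zero; suc; _+_; _*_; _∸_; _^_; _!)
  open import Data.Nat.Properties
  open import Data.Nat.DivMod using (_/_; m*n/n≡m)
  open import Data.Nat.Tactic.RingSolver using (solve-∀)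
  open import Relation.Binary.PropositionalEquality

  -- completions Q n d k = (Qⁿ − Q^d)(Qⁿ − Q^(d+1))⋯(Qⁿ − Q^(d+k−1)): the number of ways to extend
  -- d independent vectors of 𝔽_Qⁿ by k further vectors, chosen one at a time outside the current span.
  completions : ℕ → ℕ → ℕ → ℕ → ℕ
  completions Q n d zero = 1
  completions Q n d (suc k) = (Q ^ n ∸ Q ^ d) * completions Q n (suc d) k

  triangular : ℕ → ℕ
  triangular zero = 0
  triangular (suc m) = m + triangular m

  triangular-double : ∀ m → (m + triangular m) * 2 ≡ suc m * m
  triangular-double zero = refl
  triangular-double (suc m) = trans (expand m (triangular m)) (trans (cong (λ z → suc m * 2 + z) (triangular-double m)) (collect m))
    where
    expand : ∀ m t → (suc m + (m + t)) * 2 ≡ suc m * 2 + (m + t) * 2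
    expand = solve-∀
    collect : ∀ m → suc m * 2 + suc m * m ≡ suc (suc m) * suc m
    collect = solve-∀

  triangular-half : ∀ m → (suc m * m) / 2 ≡ m + triangular m
  triangular-half m = trans (cong (_/ 2) (sym (triangular-double m))) (m*n/n≡m (m + triangular m) 2)

  prodℕ-cong : ∀ m (f g : ℕ → ℕ) → (∀ l → f l ≡ g l) → prodℕ m f ≡ prodℕ m g
  prodℕ-cong zero f g e = refl
  prodℕ-cong (suc m) f g e = cong₂ _*_ (prodℕ-cong m f g e) (e (suc m))

  prodℕ-* : ∀ m (f : ℕ → ℕ) c → prodℕ m (λ l → f l * c) ≡ prodℕ m f * c ^ m
  prodℕ-* zero f c = refl
  prodℕ-* (suc m) f c rewrite prodℕ-* m f c = regroup (prodℕ m f) (f (suc m)) c (c ^ m)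
    where
    regroup : ∀ p a c cm → p * cm * (a * c) ≡ p * a * (c * cm)
    regroup = solve-∀

  module Q≥2 (r : ℕ) where
    Q = suc (suc r)
    Q∸1 = suc r

    geometric : ℕ → ℕ
    geometric zero = 0
    geometric (suc l) = Q ^ l + geometric l

    geometric-sum : ∀ l → geometric l * Q∸1 + 1 ≡ Q ^ l
    geometric-sum zero = refl
    geometric-sum (suc l) = trans (split (Q ^ l) (geometric l)) (trans (cong (λ z → Q ^ l * Q∸1 + z) (geometric-sum l)) (merge (Q ^ l) r))
      where
      split : ∀ a g → (a + g) * Q∸1 + 1 ≡ a * Q∸1 + (g * Q∸1 + 1)
      split a g = trans (cong (_+ 1) (*-distribʳ-+ Q∸1 a g)) (+-assoc (a * Q∸1) (g * Q∸1) 1)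
      merge : ∀ a r → a * suc r + a ≡ suc (suc r) * a
      merge = solve-∀

    qint≡geometric : ∀ l → qint Q l ≡ geometric l
    qint≡geometric l = trans (cong (_/ Q∸1) (trans (cong (_∸ 1) (sym (geometric-sum l))) (m+n∸n≡m (geometric l * Q∸1) 1))) (m*n/n≡m (geometric l) Q∸1)

    qint-* : ∀ l → qint Q l * Q∸1 ≡ Q ^ l ∸ 1
    qint-* l = trans (cong (_* Q∸1) (qint≡geometric l)) (sym (trans (cong (_∸ 1) (sym (geometric-sum l))) (m+n∸n≡m (geometric l * Q∸1) 1)))

    ∏[Q^l∸1] : ℕ → ℕ
    ∏[Q^l∸1] k = prodℕ k (λ l → Q ^ l ∸ 1)

    ∏[Q^l∸1]≡∏qint*Q∸1^ : ∀ k → ∏[Q^l∸1] k ≡ prodℕ k (qint Q) * Q∸1 ^ k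
    ∏[Q^l∸1]≡∏qint*Q∸1^ k = trans (prodℕ-cong k _ _ (λ l → sym (qint-* l))) (prodℕ-* k (qint Q) Q∸1)

    completions-closed : ∀ k d → completions Q (d + k) d k ≡ Q ^ (d * k + triangular k) * ∏[Q^l∸1] k
    completions-closed zero d = sym (trans (cong (λ z → Q ^ z * 1) (trans (+-identityʳ (d * 0)) (*-zeroʳ d))) refl)
    completions-closed (suc k) d = begin
        (Q ^ (d + suc k) ∸ Q ^ d) * completions Q (d + suc k) (suc d) k
      ≡⟨ cong (λ z → (Q ^ (d + suc k) ∸ Q ^ d) * completions Q z (suc d) k) (+-suc d k) ⟩
        (Q ^ (d + suc k) ∸ Q ^ d) * completions Q (suc d + k) (suc d) k
      ≡⟨ cong₂ _*_ factor-Q^d (completions-closed k (suc d)) ⟩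
        (Q ^ d * (Q ^ suc k ∸ 1)) * (Q ^ (suc d * k + triangular k) * ∏[Q^l∸1] k)
      ≡⟨ regroup (Q ^ d) (Q ^ suc k ∸ 1) (Q ^ (suc d * k + triangular k)) (∏[Q^l∸1] k) ⟩
        (Q ^ d * Q ^ (suc d * k + triangular k)) * (∏[Q^l∸1] k * (Q ^ suc k ∸ 1))
      ≡⟨ cong (_* (∏[Q^l∸1] k * (Q ^ suc k ∸ 1))) (trans (sym (^-distribˡ-+-* Q d (suc d * k + triangular k))) (cong (Q ^_) (exponent-sum d k (triangular k)))) ⟩
        Q ^ (d * suc k + triangular (suc k)) * ∏[Q^l∸1] (suc k)
      ∎
      where
      open ≡-Reasoning
      factor-Q^d : Q ^ (d + suc k) ∸ Q ^ d ≡ Q ^ d * (Q ^ suc k ∸ 1)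
      factor-Q^d = trans (cong₂ _∸_ (^-distribˡ-+-* Q d (suc k)) (sym (*-identityʳ (Q ^ d)))) (sym (*-distribˡ-∸ (Q ^ d) (Q ^ suc k) 1))
      regroup : ∀ a b c p → (a * b) * (c * p) ≡ (a * c) * (p * b)
      regroup = solve-∀
      exponent-sum : ∀ d k t → d + (suc d * k + t) ≡ d * suc k + (k + t)
      exponent-sum = solve-∀


    completions-t-coeff : ∀ m h → h * (m ! * Q∸1 ^ m) ≡ completions Q (suc (suc m)) 2 m → h * m ! ≡ t-coeff (suc (suc m)) Q * Q ^ m
    completions-t-coeff m h e = *-cancelʳ-≡ (h * m !) (t-coeff (suc (suc m)) Q * Q ^ m) (Q∸1 ^ m) {{m^n≢0 Q∸1 m}} (begin
        h * m ! * Q∸1 ^ m                      ≡⟨ *-assoc h (m !) (Q∸1 ^ m) ⟩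
        h * (m ! * Q∸1 ^ m)                    ≡⟨ e ⟩
        completions Q (2 + m) 2 m                      ≡⟨ completions-closed m 2 ⟩
        Q ^ (2 * m + triangular m) * ∏[Q^l∸1] m              ≡⟨ cong₂ _*_ (cong (Q ^_) (exponent-sum m (triangular m))) (∏[Q^l∸1]≡∏qint*Q∸1^ m) ⟩
        Q ^ ((m + triangular m) + m) * (PR * Q∸1 ^ m)   ≡⟨ cong (_* (PR * Q∸1 ^ m)) (^-distribˡ-+-* Q (m + triangular m) m) ⟩
        Q ^ (m + triangular m) * Q ^ m * (PR * Q∸1 ^ m) ≡⟨ regroup (Q ^ (m + triangular m)) (Q ^ m) PR (Q∸1 ^ m) ⟩
        Q ^ (m + triangular m) * PR * Q ^ m * Q∸1 ^ m   ≡⟨ cong (λ z → Q ^ z * PR * Q ^ m * Q∸1 ^ m) (sym (triangular-half m)) ⟩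
        t-coeff (suc (suc m)) Q * Q ^ m * Q∸1 ^ m ∎)
      where
      open ≡-Reasoning
      PR = prodℕ m (qint Q)
      exponent-sum : ∀ m t → 2 * m + t ≡ (m + t) + m
      exponent-sum = solve-∀
      regroup : ∀ a b p c → a * b * (p * c) ≡ a * p * b * c
      regroup = solve-∀

    kernel-sizes-arith : ∀ m c1 c2 a → c1 * Q ^ 1 ≡ Q ^ suc (suc m) → c2 * Q ^ 2 ≡ Q ^ suc (suc m) → c2 + a * Q∸1 ≡ c1 → a ≡ Q ^ m
    kernel-sizes-arith m c1 c2 a e1 e2 e3 = *-cancelʳ-≡ a (Q ^ m) Q∸1 (+-cancelˡ-≡ (Q ^ m) (a * Q∸1) (Q ^ m * Q∸1)
        (trans (cong (_+ a * Q∸1) (sym c2≡)) (trans e3 (trans c1≡ (expand (Q ^ m) r)))))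
      where
      c1≡ : c1 ≡ Q ^ suc m
      c1≡ = *-cancelʳ-≡ c1 (Q ^ suc m) (Q ^ 1) {{m^n≢0 Q 1}} (trans e1 (trans (cong (Q ^_) (+-comm 1 (suc m))) (^-distribˡ-+-* Q (suc m) 1)))
      c2≡ : c2 ≡ Q ^ m
      c2≡ = *-cancelʳ-≡ c2 (Q ^ m) (Q ^ 2) {{m^n≢0 Q 2}} (trans e2 (trans (cong (Q ^_) (+-comm 2 m)) (^-distribˡ-+-* Q m 2)))
      expand : ∀ x r → suc (suc r) * x ≡ x + x * suc r
      expand = solve-∀

module LinearCombinations {c ℓ} (𝔽 : FiniteField c ℓ) where

  open FiniteField 𝔽
  open CommutativeRing commRing
  open LinAlg 𝔽 public
  open import Level using (_⊔_)
  open import Data.Nat as ℕ using (ℕ; zero; suc)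
  open import Data.Nat.Properties using (suc-injective)
  open import Data.List using (List; []; _∷_; map; _++_; length; replicate; zipWith)
  open import Data.List.Properties using (length-++; length-replicate; length-map)
  open import Data.List.Relation.Unary.All using (All; []; _∷_)
  open import Data.List.Relation.Unary.All.Properties using (++⁺; ++⁻ˡ; ++⁻ʳ)
  open import Data.List.Relation.Unary.Any using (Any; here; there)
  open import Data.List.Relation.Binary.Pointwise using (Pointwise; []; _∷_)
  open import Data.Product using (Σ; _×_; _,_)
  open import Data.Fin using (Fin) renaming (zero to fz; suc to fs)
  open import Data.Vec using (Vec; lookup; toList) renaming ([] to []v; _∷_ to _∷v_)
  open import Data.Empty using (⊥; ⊥-elim)
  open import Relation.Nullary using (¬_; yes; no)
  open import Relation.Binary.PropositionalEquality as ≡ using (_≡_)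
  open import Relation.Binary.Reasoning.Setoid setoid
  open import Algebra.Properties.AbelianGroup +-abelianGroup using (⁻¹-∙-comm)
  open import Algebra.Properties.CommutativeSemigroup +-commutativeSemigroup using (interchange)
  open import Algebra.Properties.Ring ring using (-‿distribˡ-*; -‿distribʳ-*; -1*x≈-x)
  open import Algebra.Properties.Group +-group using (⁻¹-involutive; ε⁻¹≈ε; inverseʳ-unique)
    renaming (x∙y⁻¹≈ε⇒x≈y to x-y≈0⇒x≈y)

  x*y≈0⇒y≈0 : ∀ x y → ¬ (x ≈ 0#) → x * y ≈ 0# → y ≈ 0#
  x*y≈0⇒y≈0 x y nz e with inverse x nz
  ... | (x' , xx') = begin
      y               ≈⟨ sym (*-identityˡ y) ⟩
      1# * y          ≈⟨ *-congʳ (sym xx') ⟩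
      (x * x') * y    ≈⟨ *-congʳ (*-comm x x') ⟩
      (x' * x) * y    ≈⟨ *-assoc x' x y ⟩
      x' * (x * y)    ≈⟨ *-congˡ e ⟩
      x' * 0#         ≈⟨ zeroʳ x' ⟩
      0#              ∎

  -1≉0 : ¬ (- 1# ≈ 0#)
  -1≉0 e = 0≉1 (sym (begin
      1#          ≈⟨ sym (⁻¹-involutive 1#) ⟩
      - (- 1#)    ≈⟨ -‿cong e ⟩
      - 0#        ≈⟨ ε⁻¹≈ε ⟩
      0#          ∎))

  V : ℕ → Set c
  V n = Vecⁿ n

  -- lc zips coefficients with vectors and ignores surplus entries on either side,
  -- hence the length conditions in Indep and InSpan.
  lc : ∀ {n} → List Carrier → List (V n) → V n
  lc []       _        k = 0#
  lc (a ∷ cs) []       k = 0#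
  lc (a ∷ cs) (w ∷ ws) k = a * w k + lc cs ws k

  Indep : ∀ {n} → List (V n) → Set (c ⊔ ℓ)
  Indep ws = ∀ cs → length cs ≡ length ws → IsZeroVec (lc cs ws) → All (_≈ 0#) cs

  InSpan : ∀ {n} → List (V n) → V n → Set (c ⊔ ℓ)
  InSpan ws w = Σ (List Carrier) λ cs → length cs ≡ length ws × (∀ k → lc cs ws k ≈ w k)

  infix 4 _≋_
  _≋_ : List Carrier → List Carrier → Set (c ⊔ ℓ)
  _≋_ = Pointwise _≈_

  lc-cong : ∀ {n} {cs ds} (ws : List (V n)) → cs ≋ ds → ∀ k → lc cs ws k ≈ lc ds ws k
  lc-cong ws [] k = refl
  lc-cong [] (e ∷ p) k = refl
  lc-cong (w ∷ ws) (e ∷ p) k = +-cong (*-congʳ e) (lc-cong ws p k)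

  All-≋ : ∀ {cs ds} → cs ≋ ds → All (_≈ 0#) ds → All (_≈ 0#) cs
  All-≋ [] [] = []
  All-≋ (e ∷ p) (z ∷ zs) = trans e z ∷ All-≋ p zs

  zeros : ℕ → List Carrier
  zeros m = replicate m 0#

  lc-zeros : ∀ {n} (u ws : List (V n)) cs → ∀ k → lc (zeros (length u) ++ cs) (u ++ ws) k ≈ lc cs ws k
  lc-zeros [] ws cs k = refl
  lc-zeros (x ∷ u) ws cs k = trans (+-cong (zeroˡ (x k)) (lc-zeros u ws cs k)) (+-identityˡ _)

  lc-zerosʳ : ∀ {n} (ws : List (V n)) m → ∀ k → lc (zeros m) ws k ≈ 0#
  lc-zerosʳ ws zero k = refl
  lc-zerosʳ [] (suc m) k = refl
  lc-zerosʳ (w ∷ ws) (suc m) k = trans (+-cong (zeroˡ (w k)) (lc-zerosʳ ws m k)) (+-identityˡ _)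

  lc-++ : ∀ {n} cs ds (ws us : List (V n)) → length cs ≡ length ws → ∀ k →
          lc (cs ++ ds) (ws ++ us) k ≈ lc cs ws k + lc ds us k
  lc-++ [] ds [] us eq k = sym (+-identityˡ _)
  lc-++ (a ∷ cs) ds (w ∷ ws) us eq k =
    trans (+-congˡ (lc-++ cs ds ws us (suc-injective eq) k)) (sym (+-assoc _ _ _))

  lc-scale : ∀ {n} s cs (ws : List (V n)) k → lc (map (s *_) cs) ws k ≈ s * lc cs ws k
  lc-scale s [] ws k = sym (zeroʳ s)
  lc-scale s (a ∷ cs) [] k = sym (zeroʳ s)
  lc-scale s (a ∷ cs) (w ∷ ws) k = begin
      s * a * w k + lc (map (s *_) cs) ws k  ≈⟨ +-cong (*-assoc s a (w k)) (lc-scale s cs ws k) ⟩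
      s * (a * w k) + s * lc cs ws k         ≈⟨ sym (distribˡ s _ _) ⟩
      s * (a * w k + lc cs ws k)             ∎

  split-around-pair : ∀ {n} (u : List (V n)) x y s (cs : List Carrier) → length cs ≡ length (u ++ x ∷ y ∷ s) →
    Σ (List Carrier) λ cu → Σ Carrier λ a → Σ Carrier λ b → Σ (List Carrier) λ cs' →
      (cs ≡ cu ++ a ∷ b ∷ cs') × (length cu ≡ length u) × (length cs' ≡ length s)
  split-around-pair [] x y s (a ∷ b ∷ cs') eq = [] , a , b , cs' , ≡.refl , ≡.refl , suc-injective (suc-injective eq)
  split-around-pair (z ∷ u) x y s (a ∷ cs) eq with split-around-pair u x y s cs (suc-injective eq)
  ... | cu , a' , b' , cs' , ≡.refl , l1 , l2 = a ∷ cu , a' , b' , cs' , ≡.refl , ≡.cong suc l1 , l2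

  lc-swap : ∀ {n} cu a b cs (u : List (V n)) x y s → length cu ≡ length u → ∀ k →
    lc (cu ++ a ∷ b ∷ cs) (u ++ x ∷ y ∷ s) k ≈ lc (cu ++ b ∷ a ∷ cs) (u ++ y ∷ x ∷ s) k
  lc-swap [] a b cs [] x y s eq k = begin
      a * x k + (b * y k + lc cs s k)   ≈⟨ sym (+-assoc _ _ _) ⟩
      (a * x k + b * y k) + lc cs s k   ≈⟨ +-congʳ (+-comm _ _) ⟩
      (b * y k + a * x k) + lc cs s k   ≈⟨ +-assoc _ _ _ ⟩
      b * y k + (a * x k + lc cs s k)   ∎
  lc-swap (d ∷ cu) a b cs (z ∷ u) x y s eq k = +-congˡ (lc-swap cu a b cs u x y s (suc-injective eq) k)

  All-swap : ∀ cu a b cs → All (_≈ 0#) (cu ++ a ∷ b ∷ cs) → All (_≈ 0#) (cu ++ b ∷ a ∷ cs)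
  All-swap cu a b cs h with ++⁻ʳ cu h
  ... | pa ∷ pb ∷ pc = ++⁺ (++⁻ˡ cu h) (pb ∷ pa ∷ pc)

  Indep-swap : ∀ {n} (u : List (V n)) x y s → Indep (u ++ x ∷ y ∷ s) → Indep (u ++ y ∷ x ∷ s)
  Indep-swap u x y s ind cs eq z with split-around-pair u y x s cs eq
  ... | cu , a , b , cs' , ≡.refl , l1 , l2 = All-swap cu b a cs' (ind (cu ++ b ∷ a ∷ cs') lengths combination≈0)
    where
    lengths : length (cu ++ b ∷ a ∷ cs') ≡ length (u ++ x ∷ y ∷ s)
    lengths = ≡.trans (length-++ cu) (≡.trans (≡.cong₂ ℕ._+_ l1 (≡.cong (λ m → suc (suc m)) l2)) (≡.sym (length-++ u)))
    combination≈0 : IsZeroVec (lc (cu ++ b ∷ a ∷ cs') (u ++ x ∷ y ∷ s))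
    combination≈0 k = trans (sym (lc-swap cu a b cs' u y x s l1 k)) (z k)

  Indep-prefix : ∀ {n} (ws us : List (V n)) → Indep (ws ++ us) → Indep ws
  Indep-prefix ws us ind cs eq z = ++⁻ˡ cs (ind (cs ++ zeros (length us)) lengths combination≈0)
    where
    lengths : length (cs ++ zeros (length us)) ≡ length (ws ++ us)
    lengths = ≡.trans (length-++ cs) (≡.trans (≡.cong₂ ℕ._+_ eq (length-replicate (length us))) (≡.sym (length-++ ws)))
    combination≈0 : IsZeroVec (lc (cs ++ zeros (length us)) (ws ++ us))
    combination≈0 k = trans (lc-++ cs (zeros (length us)) ws us eq k) (trans (+-cong (z k) (lc-zerosʳ us (length us) k)) (+-identityˡ 0#))

  lc-negate-member : ∀ {n} {w : V n} {s : List (V n)} → Any (_≡ w) s →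
    Σ (List Carrier) λ e → (length e ≡ length s) × (∀ k → lc e s k ≈ - w k)
  lc-negate-member {w = w} {s = z ∷ s} (here ≡.refl) = (- 1# ∷ zeros (length s)) , ≡.cong suc (length-replicate (length s)) , combination≈
    where combination≈ : ∀ k → - 1# * w k + lc (zeros (length s)) s k ≈ - w k
          combination≈ k = trans (+-cong (-1*x≈-x (w k)) (lc-zerosʳ s (length s) k)) (+-identityʳ _)
  lc-negate-member {w = w} {s = z ∷ s} (there p) with lc-negate-member p
  ... | e , le , pe = (0# ∷ e) , ≡.cong suc le , λ k → trans (+-cong (zeroˡ (z k)) (pe k)) (+-identityˡ _)

  ¬Indep-duplicate : ∀ {n} (u : List (V n)) w s → Any (_≡ w) s → ¬ Indep (u ++ w ∷ s)
  ¬Indep-duplicate u w s w∈s ind with lc-negate-member w∈s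
  ... | e , le , pe = head≉0 (++⁻ʳ (zeros (length u)) (ind (zeros (length u) ++ 1# ∷ e) lengths combination≈0))
    where
    head≉0 : All (_≈ 0#) (1# ∷ e) → ⊥
    head≉0 (h ∷ _) = 0≉1 (sym h)
    lengths : length (zeros (length u) ++ 1# ∷ e) ≡ length (u ++ w ∷ s)
    lengths = ≡.trans (length-++ (zeros (length u))) (≡.trans (≡.cong₂ ℕ._+_ (length-replicate (length u)) (≡.cong suc le)) (≡.sym (length-++ u)))
    combination≈0 : IsZeroVec (lc (zeros (length u) ++ 1# ∷ e) (u ++ w ∷ s))
    combination≈0 k = trans (lc-zeros u (w ∷ s) (1# ∷ e) k) (trans (+-cong (*-identityˡ (w k)) (pe k)) (-‿inverseʳ (w k)))

  unsnoc : ∀ {n} (ws : List (V n)) w (cs : List Carrier) → length cs ≡ length (ws ++ w ∷ []) →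
    Σ (List Carrier) λ cs' → Σ Carrier λ a → (cs ≡ cs' ++ a ∷ []) × (length cs' ≡ length ws)
  unsnoc [] w (a ∷ []) eq = [] , a , ≡.refl , ≡.refl
  unsnoc (z ∷ ws) w (b ∷ cs) eq with unsnoc ws w cs (suc-injective eq)
  ... | cs' , a , ≡.refl , l = (b ∷ cs') , a , ≡.refl , ≡.cong suc l

  Indep-snoc⇒∉span : ∀ {n} (ws : List (V n)) w → Indep (ws ++ w ∷ []) → ¬ InSpan ws w
  Indep-snoc⇒∉span ws w ind (cs , l , e) = head≉0 (++⁻ʳ cs (ind (cs ++ - 1# ∷ []) lengths combination≈0))
    where
    head≉0 : All (_≈ 0#) (- 1# ∷ []) → ⊥
    head≉0 (h ∷ _) = -1≉0 h
    lengths : length (cs ++ - 1# ∷ []) ≡ length (ws ++ w ∷ [])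
    lengths = ≡.trans (length-++ cs) (≡.trans (≡.cong (ℕ._+ 1) l) (≡.sym (length-++ ws)))
    combination≈0 : IsZeroVec (lc (cs ++ - 1# ∷ []) (ws ++ w ∷ []))
    combination≈0 k = trans (lc-++ cs (- 1# ∷ []) ws (w ∷ []) l k)
             (trans (+-cong (e k) (trans (+-identityʳ _) (-1*x≈-x (w k)))) (-‿inverseʳ (w k)))

  Indep-snoc : ∀ {n} (ws : List (V n)) w → Indep ws → ¬ InSpan ws w → Indep (ws ++ w ∷ [])
  Indep-snoc ws w ind w∉span cs eq z with unsnoc ws w cs eq
  ... | cs' , a , ≡.refl , l with a ≟ 0#
  ...   | yes a≈0 = ++⁺ (ind cs' l (λ k → trans (sym (+-identityʳ _)) (trans (+-congˡ (sym (last≈0 k))) (split-last k)))) (a≈0 ∷ [])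
    where
    split-last : ∀ k → lc cs' ws k + (a * w k + 0#) ≈ 0#
    split-last k = trans (sym (lc-++ cs' (a ∷ []) ws (w ∷ []) l k)) (z k)
    last≈0 : ∀ k → a * w k + 0# ≈ 0#
    last≈0 k = trans (+-identityʳ _) (trans (*-congʳ a≈0) (zeroˡ (w k)))
  ...   | no a≉0 with inverse a a≉0
  ...     | a' , a*a'≈1 = ⊥-elim (w∉span (map ((- a') *_) cs' , ≡.trans (length-map _ cs') l , combination≈))
    where
    combination≈ : ∀ k → lc (map ((- a') *_) cs') ws k ≈ w k
    combination≈ k = begin
        lc (map ((- a') *_) cs') ws k    ≈⟨ lc-scale (- a') cs' ws k ⟩
        (- a') * X                       ≈⟨ sym (-‿distribˡ-* a' X) ⟩
        - (a' * X)                       ≈⟨ -‿distribʳ-* a' X ⟩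
        a' * (- X)                       ≈⟨ *-congˡ (sym a*w≈-X) ⟩
        a' * (a * w k)                   ≈⟨ sym (*-assoc a' a (w k)) ⟩
        (a' * a) * w k                   ≈⟨ *-congʳ (trans (*-comm a' a) a*a'≈1) ⟩
        1# * w k                         ≈⟨ *-identityˡ (w k) ⟩
        w k                              ∎
      where
      X = lc cs' ws k
      a*w≈-X : a * w k ≈ - X
      a*w≈-X = inverseʳ-unique X (a * w k) (trans (+-congˡ (sym (+-identityʳ _))) (trans (sym (lc-++ cs' (a ∷ []) ws (w ∷ []) l k)) (z k)))

  sub : List Carrier → List Carrier → List Carrier
  sub = zipWith (λ a b → a + - b)

  lc-sub : ∀ {n} cs ds (ws : List (V n)) → length cs ≡ length ds → ∀ k → lc (sub cs ds) ws k ≈ lc cs ws k + - lc ds ws k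
  lc-sub [] [] ws l k = sym (trans (+-identityˡ _) ε⁻¹≈ε)
  lc-sub (a ∷ cs) (b ∷ ds) [] l k = sym (trans (+-identityˡ _) ε⁻¹≈ε)
  lc-sub (a ∷ cs) (b ∷ ds) (w ∷ ws) l k = begin
      (a + - b) * w k + lc (sub cs ds) ws k
        ≈⟨ +-cong (distribʳ (w k) a (- b)) (lc-sub cs ds ws (suc-injective l) k) ⟩
      (a * w k + - b * w k) + (lc cs ws k + - lc ds ws k)
        ≈⟨ interchange _ _ _ _ ⟩
      (a * w k + lc cs ws k) + (- b * w k + - lc ds ws k)
        ≈⟨ +-congˡ (trans (+-congʳ (sym (-‿distribˡ-* b (w k)))) (⁻¹-∙-comm _ _)) ⟩
      (a * w k + lc cs ws k) + - (b * w k + lc ds ws k)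
        ∎

  length-sub : ∀ cs ds → length cs ≡ length ds → length (sub cs ds) ≡ length cs
  length-sub [] [] l = ≡.refl
  length-sub (a ∷ cs) (b ∷ ds) l = ≡.cong suc (length-sub cs ds (suc-injective l))

  sub≈0⇒≋ : ∀ cs ds → length cs ≡ length ds → All (_≈ 0#) (sub cs ds) → cs ≋ ds
  sub≈0⇒≋ [] [] l [] = []
  sub≈0⇒≋ (a ∷ cs) (b ∷ ds) l (h ∷ hs) = x-y≈0⇒x≈y a b h ∷ sub≈0⇒≋ cs ds (suc-injective l) hs

  lc-inj : ∀ {n} (ws : List (V n)) → Indep ws → ∀ cs ds → length cs ≡ length ws → length ds ≡ length ws →
           (∀ k → lc cs ws k ≈ lc ds ws k) → cs ≋ ds
  lc-inj ws ind cs ds l1 l2 e = sub≈0⇒≋ cs ds l12 (ind (sub cs ds) (≡.trans (length-sub cs ds l12) l1)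
      (λ k → trans (lc-sub cs ds ws l12 k) (trans (+-congʳ (e k)) (-‿inverseʳ _))))
    where l12 = ≡.trans l1 (≡.sym l2)

  family : ∀ {N n m} → (Fin N → V n) → Vec (Fin N) m → List (V n)
  family v t = map v (toList t)

  length-family : ∀ {N n m} (v : Fin N → V n) (t : Vec (Fin N) m) → length (family v t) ≡ m
  length-family v []v = ≡.refl
  length-family v (x ∷v t) = ≡.cong suc (length-family v t)

  toCoeffs : ∀ {m} → (Fin m → Carrier) → List Carrier
  toCoeffs {zero} cs = []
  toCoeffs {suc m} cs = cs fz ∷ toCoeffs (λ a → cs (fs a))

  length-toCoeffs : ∀ {m} (cs : Fin m → Carrier) → length (toCoeffs cs) ≡ m
  length-toCoeffs {zero} cs = ≡.refl
  length-toCoeffs {suc m} cs = ≡.cong suc (length-toCoeffs (λ a → cs (fs a)))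

  fromCoeffs : List Carrier → ∀ {m} → Fin m → Carrier
  fromCoeffs [] _ = 0#
  fromCoeffs (a ∷ cs) fz = a
  fromCoeffs (a ∷ cs) (fs k) = fromCoeffs cs k

  lincomb≈lc : ∀ {N n m} (v : Fin N → V n) (t : Vec (Fin N) m) (cs : Fin m → Carrier) k →
    lincomb cs (λ a → v (lookup t a)) k ≈ lc (toCoeffs cs) (family v t) k
  lincomb≈lc v []v cs k = refl
  lincomb≈lc v (x ∷v t) cs k = +-congˡ (lincomb≈lc v t (λ a → cs (fs a)) k)

  lincomb-fromCoeffs≈lc : ∀ {N n m} (v : Fin N → V n) (t : Vec (Fin N) m) (cs : List Carrier) → length cs ≡ m → ∀ k →
    lincomb (fromCoeffs cs) (λ a → v (lookup t a)) k ≈ lc cs (family v t) k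
  lincomb-fromCoeffs≈lc v []v [] l k = refl
  lincomb-fromCoeffs≈lc v (x ∷v t) (a ∷ cs) l k = +-congˡ (lincomb-fromCoeffs≈lc v t cs (suc-injective l) k)

  fromCoeffs≈0⇒All : ∀ {m} (cs : List Carrier) → length cs ≡ m → (∀ (a : Fin m) → fromCoeffs cs a ≈ 0#) → All (_≈ 0#) cs
  fromCoeffs≈0⇒All [] l h = []
  fromCoeffs≈0⇒All {suc m} (a ∷ cs) l h = h fz ∷ fromCoeffs≈0⇒All cs (suc-injective l) (λ k → h (fs k))

  All⇒toCoeffs≈0 : ∀ {m} (cs : Fin m → Carrier) → All (_≈ 0#) (toCoeffs cs) → ∀ a → cs a ≈ 0#
  All⇒toCoeffs≈0 {suc m} cs (h ∷ hs) fz = h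
  All⇒toCoeffs≈0 {suc m} cs (h ∷ hs) (fs a) = All⇒toCoeffs≈0 (λ a → cs (fs a)) hs a

  LI⇒Indep : ∀ {N n m} (v : Fin N → V n) (t : Vec (Fin N) m) → LinearlyIndependent (λ a → v (lookup t a)) → Indep (family v t)
  LI⇒Indep v t li cs l z = fromCoeffs≈0⇒All cs l' (li (fromCoeffs cs) (λ k → trans (lincomb-fromCoeffs≈lc v t cs l' k) (z k)))
    where l' = ≡.trans l (length-family v t)

  Indep⇒LI : ∀ {N n m} (v : Fin N → V n) (t : Vec (Fin N) m) → Indep (family v t) → LinearlyIndependent (λ a → v (lookup t a))
  Indep⇒LI v t ind cs z = All⇒toCoeffs≈0 cs (ind (toCoeffs cs) (≡.trans (length-toCoeffs cs) (≡.sym (length-family v t)))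
      (λ k → trans (sym (lincomb≈lc v t cs k)) (z k)))

module FiniteLinearAlgebra {c ℓ} (𝔽 : FiniteField c ℓ) where

  open FiniteField 𝔽
  open CommutativeRing commRing
  open Counting
  open LinearCombinations 𝔽 public
  open import Data.Nat as ℕ using (ℕ; zero; suc)
  open import Data.Nat.Properties using (suc-injective) renaming (+-comm to +-commᴺ)
  open import Data.Bool using (Bool; true; false; _∧_; not)
  open import Data.List using (List; []; _∷_; _++_; map; length)
  open import Data.List.Properties using (length-map; length-replicate)
  open import Data.List.Relation.Unary.All as All using (All; []; _∷_)
  import Data.List.Relation.Binary.Pointwise as Pw
  open Pw using ([]; _∷_)
  open import Data.Fin using (Fin)
  open import Data.Fin.Properties using (all?)
  open import Data.Vec using (Vec; lookup; tabulate; replicate) renaming ([] to []v; _∷_ to _∷v_)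
  open import Data.Vec.Properties using (lookup∘tabulate; tabulate∘lookup; tabulate-cong)
  open import Data.Product using (Σ; _×_; _,_; proj₁; proj₂)
  open import Function using (case_of_)
  open import Data.Sum using (_⊎_; inj₁; inj₂)
  open import Data.Empty using (⊥-elim)
  open import Relation.Nullary using (¬_; Dec; yes; no; does)
  open import Relation.Nullary.Decidable using (dec-true; dec-false)
  open import Relation.Binary.PropositionalEquality as ≡ using (_≡_)

  -- Vectors of 𝔽ⁿ are enumerated through their coordinate codes in Fin q, and
  -- span membership and independence are decided by exhaustive search over codes.
  𝔽-enum : Enum (Fin q)
  𝔽-enum = finEnum q

  𝔽ⁿ-enum : (n : ℕ) → Enum (Vec (Fin q) n)
  𝔽ⁿ-enum n = vecEnum 𝔽-enum n

  code : Carrier → Fin q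
  code x = proj₁ (enum-surj x)

  code-correct : ∀ x → enum (code x) ≈ x
  code-correct x = proj₂ (enum-surj x)

  ⟦_⟧ : ∀ {n} → Vec (Fin q) n → V n
  ⟦ cc ⟧ k = enum (lookup cc k)

  encode : ∀ {n} → V n → Vec (Fin q) n
  encode w = tabulate (λ k → code (w k))

  ⟦encode⟧ : ∀ {n} (w : V n) k → ⟦ encode w ⟧ k ≈ w k
  ⟦encode⟧ w k rewrite lookup∘tabulate (λ k → code (w k)) k = code-correct (w k)

  ⟦⟧-injective : ∀ {n} (u w : Vec (Fin q) n) → (∀ k → ⟦ u ⟧ k ≈ ⟦ w ⟧ k) → u ≡ w
  ⟦⟧-injective u w h = ≡.trans (≡.sym (tabulate∘lookup u))
    (≡.trans (tabulate-cong (λ k → enum-inj _ _ (h k))) (tabulate∘lookup w))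

  encode-unique : ∀ {n} (x : V n) (w : Vec (Fin q) n) → (∀ k → x k ≈ ⟦ w ⟧ k) → encode x ≡ w
  encode-unique x w h = ⟦⟧-injective (encode x) w (λ k → trans (⟦encode⟧ x k) (h k))

  coeffs : ∀ {d} → Vec (Fin q) d → List Carrier
  coeffs []v = []
  coeffs (a ∷v cc) = enum a ∷ coeffs cc

  length-coeffs : ∀ {d} (cc : Vec (Fin q) d) → length (coeffs cc) ≡ d
  length-coeffs []v = ≡.refl
  length-coeffs (a ∷v cc) = ≡.cong suc (length-coeffs cc)

  coeffs-inj : ∀ {d} (u w : Vec (Fin q) d) → coeffs u ≋ coeffs w → u ≡ w
  coeffs-inj []v []v [] = ≡.refl
  coeffs-inj (a ∷v u) (b ∷v w) (e ∷ p) = ≡.cong₂ _∷v_ (enum-inj a b e) (coeffs-inj u w p)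

  codeFor : ∀ (cs : List Carrier) d → length cs ≡ d → Σ (Vec (Fin q) d) λ cc → coeffs cc ≋ cs
  codeFor []       zero    _ = []v , []
  codeFor (a ∷ cs) (suc d) e with codeFor cs d (suc-injective e)
  ... | cc , cc≋cs = code a ∷v cc , code-correct a ∷ cc≋cs

  ≈⇒does : ∀ {x y} → x ≈ y → does (x ≟ y) ≡ true
  ≈⇒does {x} {y} = dec-true (x ≟ y)

  does⇒≈ : ∀ {x y} → does (x ≟ y) ≡ true → x ≈ y
  does⇒≈ {x} {y} = does-true⁻ (x ≟ y)

  ≉⇒¬does : ∀ {x y} → ¬ x ≈ y → does (x ≟ y) ≡ false
  ≉⇒¬does {x} {y} = dec-false (x ≟ y)

  _≟ⱽ_ : ∀ {n} (w w' : V n) → Dec (∀ k → w k ≈ w' k)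
  w ≟ⱽ w' = all? (λ k → w k ≟ w' k)

  isZero? : ∀ {n} (w : V n) → Dec (IsZeroVec w)
  isZero? w = all? (λ k → w k ≟ 0#)

  allZero? : (cs : List Carrier) → Dec (All (_≈ 0#) cs)
  allZero? = All.all? (_≟ 0#)

  spannedBy? : ∀ {n} (ws : List (V n)) → V n → Vec (Fin q) (length ws) → Bool
  spannedBy? ws w cc = does (lc (coeffs cc) ws ≟ⱽ w)

  SpanSearch : ∀ {n} (ws : List (V n)) → V n → Set
  SpanSearch ws w = (Σ (Vec (Fin q) (length ws)) λ a → spannedBy? ws w a ≡ true) ⊎ All (λ x → spannedBy? ws w x ≡ false) (elems (𝔽ⁿ-enum (length ws)))

  spanSearch : ∀ {n} (ws : List (V n)) → (w : V n) → SpanSearch ws w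
  spanSearch ws w = search (spannedBy? ws w) (elems (𝔽ⁿ-enum (length ws)))

  inSpanᵇ : ∀ {n} (ws : List (V n)) → V n → Bool
  inSpanᵇ ws w = found (spanSearch ws w)

  inSpanᵇ-complete : ∀ {n} (ws : List (V n)) w → InSpan ws w → inSpanᵇ ws w ≡ true
  inSpanᵇ-complete ws w (cs , l , e) with codeFor cs (length ws) l
  ... | cc , pw = search-found (𝔽ⁿ-enum (length ws)) (spannedBy? ws w) cc
        (dec-true (_ ≟ⱽ w) (λ k → trans (lc-cong ws pw k) (e k)))

  pick : ∀ {n} (ws : List (V n)) w → SpanSearch ws w → Vec (Fin q) (length ws)
  pick ws w (inj₁ (cc , _)) = cc
  pick ws w (inj₂ _) = replicate (length ws) (code 0#)

  pick-ok : ∀ {n} (ws : List (V n)) w (r : SpanSearch ws w) → found r ≡ true → ∀ k → lc (coeffs (pick ws w r)) ws k ≈ w k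
  pick-ok ws w (inj₁ (cc , h)) _ = does-true⁻ (_ ≟ⱽ w) h

  inSpanᵇ-sound : ∀ {n} (ws : List (V n)) w → inSpanᵇ ws w ≡ true → InSpan ws w
  inSpanᵇ-sound ws w h = coeffs (pick ws w r) , length-coeffs (pick ws w r) , pick-ok ws w r h
    where r = spanSearch ws w

  dependence? : ∀ {n} (ws : List (V n)) → Vec (Fin q) (length ws) → Bool
  dependence? ws cc = does (isZero? (lc (coeffs cc) ws)) ∧ not (does (allZero? (coeffs cc)))

  dependence?-sound : ∀ {n} (ws : List (V n)) cc → dependence? ws cc ≡ true →
    IsZeroVec (lc (coeffs cc) ws) × ¬ All (_≈ 0#) (coeffs cc)
  dependence?-sound ws cc h with ∧≡true⁻ {does (isZero? (lc (coeffs cc) ws))} h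
  ... | lc≈0 , cs≉0 = does-true⁻ (isZero? _) lc≈0 ,
                      λ cs≈0 → case ≡.trans (≡.sym (not≡true⁻ cs≉0)) (dec-true (allZero? _) cs≈0) of λ ()

  indepᵇ : ∀ {n} → List (V n) → Bool
  indepᵇ ws = not (found (search (dependence? ws) (elems (𝔽ⁿ-enum (length ws)))))

  indepᵇ-complete : ∀ {n} (ws : List (V n)) → Indep ws → indepᵇ ws ≡ true
  indepᵇ-complete ws ind with search (dependence? ws) (elems (𝔽ⁿ-enum (length ws)))
  ... | inj₂ _ = ≡.refl
  ... | inj₁ (cc , h) with dependence?-sound ws cc h
  ...   | lc≈0 , cs≉0 = ⊥-elim (cs≉0 (ind (coeffs cc) (length-coeffs cc) lc≈0))

  indepᵇ-sound : ∀ {n} (ws : List (V n)) → indepᵇ ws ≡ true → Indep ws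
  indepᵇ-sound ws h cs l z with search (dependence? ws) (elems (𝔽ⁿ-enum (length ws))) in es
  indepᵇ-sound ws () cs l z | inj₁ _
  ... | inj₂ none with codeFor cs (length ws) l
  ...   | cc , pw with allZero? (coeffs cc)
  ...     | yes cc≈0 = All-≋ (Pw.symmetric sym pw) cc≈0
  ...     | no cc≉0 = ⊥-elim (all-false⇒¬true (𝔽ⁿ-enum (length ws)) (dependence? ws) none cc bad)
    where
    bad : dependence? ws cc ≡ true
    bad rewrite dec-true (isZero? (lc (coeffs cc) ws)) (λ k → trans (lc-cong ws pw k) (z k)) | dec-false (allZero? (coeffs cc)) cc≉0 = ≡.refl

  indepᵇ-swap : ∀ {n} (u : List (V n)) x y s → indepᵇ (u ++ x ∷ y ∷ s) ≡ indepᵇ (u ++ y ∷ x ∷ s)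
  indepᵇ-swap u x y s = bool-ext
    (λ h → indepᵇ-complete _ (Indep-swap u x y s (indepᵇ-sound _ h)))
    (λ h → indepᵇ-complete _ (Indep-swap u y x s (indepᵇ-sound _ h)))

  total-𝔽 : total 𝔽-enum ≡ q
  total-𝔽 = total-finEnum q

  total-𝔽ⁿ : ∀ n → total (𝔽ⁿ-enum n) ≡ q ℕ.^ n
  total-𝔽ⁿ n = ≡.trans (total-vecEnum 𝔽-enum n) (≡.cong (ℕ._^ n) total-𝔽)

  -- Independence makes cc ↦ Σ cᵢ wᵢ a bijection from 𝔽^|ws| onto the span.
  count-span : ∀ {n} (ws : List (V n)) → Indep ws →
    count (𝔽ⁿ-enum n) (λ cv → inSpanᵇ ws ⟦ cv ⟧) ≡ q ℕ.^ length ws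
  count-span {n} ws ind = ≡.trans (≡.sym bijection) (total-𝔽ⁿ (length ws))
    where
    m = length ws
    combine : Vec (Fin q) m → Vec (Fin q) n
    combine cc = encode (lc (coeffs cc) ws)
    coordinates : Vec (Fin q) n → Vec (Fin q) m
    coordinates cv = pick ws ⟦ cv ⟧ (spanSearch ws ⟦ cv ⟧)
    combine-inSpan : ∀ cc → true ≡ true → inSpanᵇ ws ⟦ combine cc ⟧ ≡ true
    combine-inSpan cc _ = inSpanᵇ-complete ws _ (coeffs cc , length-coeffs cc , λ k → sym (⟦encode⟧ _ k))
    coordinates-combine : ∀ cc → true ≡ true → coordinates (combine cc) ≡ cc
    coordinates-combine cc _ = coeffs-inj _ _ (lc-inj ws ind _ _ (length-coeffs (coordinates (combine cc))) (length-coeffs cc)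
                (λ k → trans (pick-ok ws _ (spanSearch ws ⟦ combine cc ⟧) (combine-inSpan cc ≡.refl) k) (⟦encode⟧ _ k)))
    combine-coordinates : ∀ cv → inSpanᵇ ws ⟦ cv ⟧ ≡ true → combine (coordinates cv) ≡ cv
    combine-coordinates cv h = encode-unique _ cv (pick-ok ws ⟦ cv ⟧ (spanSearch ws ⟦ cv ⟧) h)
    bijection : count (𝔽ⁿ-enum m) (λ _ → true) ≡ count (𝔽ⁿ-enum n) (λ cv → inSpanᵇ ws ⟦ cv ⟧)
    bijection = count-bijection (𝔽ⁿ-enum m) (𝔽ⁿ-enum n) (λ _ → true) (λ cv → inSpanᵇ ws ⟦ cv ⟧) combine coordinates combine-inSpan (λ _ _ → ≡.refl) coordinates-combine combine-coordinates

  -- A full-size independent family spans: its span already has all qⁿ vectors.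
  Indep⇒spans : ∀ {n} (ws : List (V n)) → Indep ws → length ws ≡ n → ∀ x → InSpan ws x
  Indep⇒spans {n} ws ind l x with inSpanᵇ-sound ws _ (count≡total⇒all (𝔽ⁿ-enum n) (λ cv → inSpanᵇ ws ⟦ cv ⟧)
         (≡.trans (count-span ws ind) (≡.trans (≡.cong (q ℕ.^_) l) (≡.sym (total-𝔽ⁿ n)))) (encode x))
  ... | cs , l , e = cs , l , λ k → trans (e k) (⟦encode⟧ x k)

  Indep⇒Basis : ∀ {N n} (v : Fin N → V n) (t : Vec (Fin N) n) → Indep (family v t) → IsBasis (λ a → v (lookup t a))
  Indep⇒Basis v t ind = Indep⇒LI v t ind , spans
    where
    spans : Spans (λ a → v (lookup t a))
    spans x with Indep⇒spans (family v t) ind (length-family v t) x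
    ... | cs , l , e = fromCoeffs cs , λ k → trans (lincomb-fromCoeffs≈lc v t cs (≡.trans l (length-family v t)) k) (e k)

  does-basis≡indepᵇ : ∀ {N n} (v : Fin N → V n) (t : Vec (Fin N) n) (d : Dec (IsBasis (λ a → v (lookup t a)))) →
    does d ≡ indepᵇ (family v t)
  does-basis≡indepᵇ v t (yes b) = ≡.sym (indepᵇ-complete _ (LI⇒Indep v t (proj₁ b)))
  does-basis≡indepᵇ v t (no nb) with indepᵇ (family v t) in e
  ... | true = ⊥-elim (nb (Indep⇒Basis v t (indepᵇ-sound _ e)))
  ... | false = ≡.refl

  nonzeroᵇ : Fin q → Bool
  nonzeroᵇ s = not (does (enum s ≟ 0#))

  count-nonzero : count 𝔽-enum nonzeroᵇ ℕ.+ 1 ≡ q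
  count-nonzero = begin
      count 𝔽-enum nonzeroᵇ ℕ.+ 1
    ≡⟨ ≡.cong (count 𝔽-enum nonzeroᵇ ℕ.+_) (≡.sym count-zero) ⟩
      count 𝔽-enum nonzeroᵇ ℕ.+ count 𝔽-enum isZero
    ≡⟨ +-commᴺ (count 𝔽-enum nonzeroᵇ) _ ⟩
      count 𝔽-enum isZero ℕ.+ count 𝔽-enum nonzeroᵇ
    ≡⟨ ≡.sym (count-split 𝔽-enum (λ _ → true) isZero) ⟩
      total 𝔽-enum
    ≡⟨ total-𝔽 ⟩
      q
    ∎
    where
    open ≡.≡-Reasoning
    isZero : Fin q → Bool
    isZero s = does (enum s ≟ 0#)
    count-zero : count 𝔽-enum isZero ≡ 1
    count-zero = sumL-δ 𝔽-enum _ (code 0#) indicator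
      where
      indicator : ∀ s → 𝟙 (isZero s) ≡ δ (deq 𝔽-enum s (code 0#))
      indicator s with enum s ≟ 0# | deq 𝔽-enum s (code 0#)
      ... | yes _   | yes _     = ≡.refl
      ... | yes s≈0 | no s≢0    = ⊥-elim (s≢0 (enum-inj _ _ (trans s≈0 (sym (code-correct 0#)))))
      ... | no s≉0  | yes ≡.refl = ⊥-elim (s≉0 (code-correct 0#))
      ... | no _    | no _      = ≡.refl

  InSpan-cong : ∀ {n} (ws : List (V n)) {x y : V n} → InSpan ws x → (∀ k → x k ≈ y k) → InSpan ws y
  InSpan-cong ws (cs , l , e) x≈y = cs , l , λ k → trans (e k) (x≈y k)

  InSpan-scale : ∀ {n} (ws : List (V n)) w s → InSpan ws w → InSpan ws (λ k → s * w k)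
  InSpan-scale ws w s (cs , l , e) = map (s *_) cs , ≡.trans (length-map _ cs) l , λ k → trans (lc-scale s cs ws k) (*-congˡ (e k))

  InSpan-zero : ∀ {n} (ws : List (V n)) → InSpan ws (λ _ → 0#)
  InSpan-zero ws = zeros (length ws) , length-replicate (length ws) , lc-zerosʳ ws (length ws)

  inSpanᵇ-cong : ∀ {n} (ws : List (V n)) w w' → (∀ k → w k ≈ w' k) → inSpanᵇ ws w ≡ inSpanᵇ ws w'
  inSpanᵇ-cong ws w w' w≈w' = bool-ext
    (λ h → inSpanᵇ-complete ws w' (InSpan-cong ws (inSpanᵇ-sound ws w h) w≈w'))
    (λ h → inSpanᵇ-complete ws w (InSpan-cong ws (inSpanᵇ-sound ws w' h) (λ k → sym (w≈w' k))))

  inSpanᵇ-scale : ∀ {n} (ws : List (V n)) w s → ¬ (s ≈ 0#) → inSpanᵇ ws (λ k → s * w k) ≡ inSpanᵇ ws w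
  inSpanᵇ-scale ws w s s≉0 with inverse s s≉0
  ... | t , s*t≈1 = bool-ext
    (λ h → inSpanᵇ-complete ws w (InSpan-cong ws (InSpan-scale ws _ t (inSpanᵇ-sound ws _ h)) unscale))
    (λ h → inSpanᵇ-complete ws _ (InSpan-scale ws w s (inSpanᵇ-sound ws w h)))
    where
    unscale : ∀ k → t * (s * w k) ≈ w k
    unscale k = trans (sym (*-assoc t s (w k))) (trans (*-congʳ (trans (*-comm t s) s*t≈1)) (*-identityˡ _))

  inSpanᵇ-false : ∀ {n} (ws : List (V n)) w → ¬ InSpan ws w → inSpanᵇ ws w ≡ false
  inSpanᵇ-false ws w w∉ with inSpanᵇ ws w in e
  ... | false = ≡.refl
  ... | true  = ⊥-elim (w∉ (inSpanᵇ-sound ws w e))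

  indepᵇ-false : ∀ {n} (ws : List (V n)) → ¬ Indep ws → indepᵇ ws ≡ false
  indepᵇ-false ws dep with indepᵇ ws in e
  ... | false = ≡.refl
  ... | true  = ⊥-elim (dep (indepᵇ-sound ws e))

  indepᵇ-++ : ∀ {n} (ws us : List (V n)) → indepᵇ ws ≡ false → indepᵇ (ws ++ us) ≡ false
  indepᵇ-++ ws us dep = indepᵇ-false (ws ++ us)
    (λ ind → case ≡.trans (≡.sym dep) (indepᵇ-complete ws (Indep-prefix ws us ind)) of λ ())

  indepᵇ-snoc : ∀ {n} (ws : List (V n)) → Indep ws → ∀ w → indepᵇ (ws ++ w ∷ []) ≡ not (inSpanᵇ ws w)
  indepᵇ-snoc ws ind w = bool-ext
    (λ h → not≡true⁺ (inSpanᵇ-false ws w (Indep-snoc⇒∉span ws w (indepᵇ-sound _ h))))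
    (λ h → indepᵇ-complete _ (Indep-snoc ws w ind
      (λ w∈ → case ≡.trans (≡.sym (not≡true⁻ h)) (inSpanᵇ-complete ws w w∈) of λ ())))

module Orthogonality {c ℓ} (𝔽 : FiniteField c ℓ) where

  open FiniteField 𝔽
  open CommutativeRing commRing
  open RingOps commRing using (∑)
  open RingSums commRing
  open Counting
  open FiniteLinearAlgebra 𝔽 public
  open import Level using (_⊔_)
  open import Data.Nat as ℕ using (ℕ; suc)
  open import Data.Nat.Properties using (suc-injective)
  open import Data.Bool using (Bool; true; _∧_; not)
  open import Function using (case_of_)
  open import Data.List using (List; []; _∷_; map; length; zipWith)
  open import Data.List.Relation.Unary.All using (All; []; _∷_)
  import Data.List.Relation.Binary.Pointwise as Pw
  open Pw using ([]; _∷_)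
  open import Data.Fin using (Fin)
  open import Data.Fin.Properties using (¬∀⟶∃¬)
  open import Data.Vec using (Vec)
  open import Data.Product using (Σ; _×_; _,_; proj₁; proj₂)
  open import Data.Sum using (inj₁; inj₂)
  open import Data.Empty using (⊥-elim)
  open import Relation.Nullary using (¬_; yes; no; does)
  open import Relation.Nullary.Decidable using (dec-true)
  open import Relation.Binary.PropositionalEquality as ≡ using (_≡_)
  open import Relation.Binary.Reasoning.Setoid setoid
  open import Algebra.Properties.CommutativeSemigroup *-commutativeSemigroup using (x∙yz≈y∙xz)
  open import Algebra.Properties.Ring ring using (-‿distribˡ-*; -1*x≈-x)
  open import Algebra.Properties.Group +-group using (//-rightDividesˡ; //-rightDividesʳ)
    renaming (x∙y⁻¹≈ε⇒x≈y to x-y≈0⇒x≈y)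

  dot-congʳ : ∀ {n} (u : V n) {w w' : V n} → (∀ k → w k ≈ w' k) → dot u w ≈ dot u w'
  dot-congʳ u w≈w' = ∑-cong (λ k → *-congˡ (w≈w' k))

  dot-comm : ∀ {n} (u w : V n) → dot u w ≈ dot w u
  dot-comm u w = ∑-cong (λ k → *-comm (u k) (w k))

  dot-zero : ∀ {n} (u : V n) → dot u (λ _ → 0#) ≈ 0#
  dot-zero {n} u = trans (∑-cong (λ k → zeroʳ (u k))) (∑-zero n)

  dot-add : ∀ {n} (u x y : V n) → dot u (λ k → x k + y k) ≈ dot u x + dot u y
  dot-add u x y = trans (∑-cong (λ k → distribˡ (u k) (x k) (y k))) (∑-+ (λ k → u k * x k) (λ k → u k * y k))

  dot-scale : ∀ {n} (u x : V n) a → dot u (λ k → a * x k) ≈ a * dot u x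
  dot-scale u x a = trans (∑-cong (λ k → x∙yz≈y∙xz (u k) a (x k))) (∑-*ˡ a (λ k → u k * x k))

  dot-lin : ∀ {n} (u x y : V n) a → dot u (λ k → a * x k + y k) ≈ a * dot u x + dot u y
  dot-lin u x y a = trans (dot-add u (λ k → a * x k) y) (+-congʳ (dot-scale u x a))

  dot-sub : ∀ {n} (u x y : V n) → dot u (λ k → x k + - y k) ≈ dot u x + - dot u y
  dot-sub u x y = trans (dot-add u x (λ k → - y k)) (+-congˡ (begin
      dot u (λ k → - y k)         ≈⟨ dot-congʳ u (λ k → sym (-1*x≈-x (y k))) ⟩
      dot u (λ k → - 1# * y k)    ≈⟨ dot-scale u y (- 1#) ⟩
      - 1# * dot u y              ≈⟨ -1*x≈-x (dot u y) ⟩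
      - dot u y                   ∎))

  dot-stdBasis : ∀ {n} (u : V n) k → dot u (stdBasis k) ≈ u k
  dot-stdBasis u k = ∑-stdBasis u k

  nonzero-entry : ∀ {n} (w : V n) → ¬ IsZeroVec w → Σ (Fin n) λ j → ¬ (w j ≈ 0#)
  nonzero-entry {n} w = ¬∀⟶∃¬ n _ (λ k → w k ≟ 0#)

  *-cancelʳ-≉0 : ∀ a b x → ¬ (x ≈ 0#) → a * x ≈ b * x → a ≈ b
  *-cancelʳ-≉0 a b x x≉0 e = x-y≈0⇒x≈y a b (x*y≈0⇒y≈0 x (a + - b) x≉0 (begin
      x * (a + - b)          ≈⟨ *-comm x _ ⟩
      (a + - b) * x          ≈⟨ distribʳ x a (- b) ⟩
      a * x + - b * x        ≈⟨ +-cong e (sym (-‿distribˡ-* b x)) ⟩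
      b * x + - (b * x)      ≈⟨ -‿inverseʳ _ ⟩
      0#                     ∎))

  does-≈0-cong : ∀ {x y} → x ≈ y → does (x ≟ 0#) ≡ does (y ≟ 0#)
  does-≈0-cong x≈y = bool-ext (λ h → ≈⇒does (trans (sym x≈y) (does⇒≈ h))) (λ h → ≈⇒does (trans x≈y (does⇒≈ h)))

  does-≈0-scale : ∀ s x → ¬ (s ≈ 0#) → does ((s * x) ≟ 0#) ≡ does (x ≟ 0#)
  does-≈0-scale s x s≉0 =
    bool-ext (λ h → ≈⇒does (x*y≈0⇒y≈0 s x s≉0 (does⇒≈ h))) (λ h → ≈⇒does (trans (*-congˡ (does⇒≈ h)) (zeroʳ s)))

  dual-vector : ∀ {n} (u : V n) → ¬ IsZeroVec u → Σ (V n) λ e → dot u e ≈ 1#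
  dual-vector u u≉0 with nonzero-entry u u≉0
  ... | j , uj≉0 with inverse (u j) uj≉0
  ...   | a , uj*a≈1 = (λ k → a * stdBasis j k) , (begin
      dot u (λ k → a * stdBasis j k)   ≈⟨ dot-scale u (stdBasis j) a ⟩
      a * dot u (stdBasis j)           ≈⟨ *-congˡ (dot-stdBasis u j) ⟩
      a * u j                          ≈⟨ *-comm a (u j) ⟩
      u j * a                          ≈⟨ uj*a≈1 ⟩
      1#                               ∎)

  dots : ∀ {n} → List (V n) → V n → List Carrier
  dots us w = map (λ u → dot u w) us

  inKernelᵇ : ∀ {n} → List (V n) → V n → Bool
  inKernelᵇ us w = does (allZero? (dots us w))

  dots-cong : ∀ {n} (us : List (V n)) {w w' : V n} → (∀ k → w k ≈ w' k) → dots us w ≋ dots us w'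
  dots-cong []       w≈w' = []
  dots-cong (u ∷ us) w≈w' = dot-congʳ u w≈w' ∷ dots-cong us w≈w'

  length-dots : ∀ {n} (us : List (V n)) w → length (dots us w) ≡ length us
  length-dots []       w = ≡.refl
  length-dots (u ∷ us) w = ≡.cong suc (length-dots us w)

  add : List Carrier → List Carrier → List Carrier
  add = zipWith _+_

  sub-cong : ∀ {as as' bs bs'} → as ≋ as' → bs ≋ bs' → sub as bs ≋ sub as' bs'
  sub-cong []       _          = []
  sub-cong (_ ∷ _)  []         = []
  sub-cong (a ∷ as) (b ∷ bs)   = +-cong a (-‿cong b) ∷ sub-cong as bs

  add-cong : ∀ {as as' bs bs'} → as ≋ as' → bs ≋ bs' → add as bs ≋ add as' bs'
  add-cong []       _          = []
  add-cong (_ ∷ _)  []         = []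
  add-cong (a ∷ as) (b ∷ bs)   = +-cong a b ∷ add-cong as bs

  sub-self : ∀ cs → All (_≈ 0#) (sub cs cs)
  sub-self []       = []
  sub-self (a ∷ cs) = -‿inverseʳ a ∷ sub-self cs

  add-zeroˡ : ∀ {as bs} → All (_≈ 0#) as → length as ≡ length bs → add as bs ≋ bs
  add-zeroˡ {bs = []}     []       _ = []
  add-zeroˡ {bs = b ∷ bs} (a ∷ as) l = trans (+-congʳ a) (+-identityˡ b) ∷ add-zeroˡ as (suc-injective l)

  dots-sub : ∀ {n} (us : List (V n)) (x y : V n) → dots us (λ k → x k + - y k) ≋ sub (dots us x) (dots us y)
  dots-sub []       x y = []
  dots-sub (u ∷ us) x y = dot-sub u x y ∷ dots-sub us x y

  dots-add : ∀ {n} (us : List (V n)) (x y : V n) → dots us (λ k → x k + y k) ≋ add (dots us x) (dots us y)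
  dots-add []       x y = []
  dots-add (u ∷ us) x y = dot-add u x y ∷ dots-add us x y

  Dual : ∀ {n} → List (V n) → List (V n) → Set (c ⊔ ℓ)
  Dual us es = ∀ ys → length ys ≡ length es → dots us (lc ys es) ≋ ys

  module _ {n} (us es : List (V n)) (us∼es : length us ≡ length es) (dual : Dual us es) where

    project : V n → V n
    project w k = w k + - lc (dots us w) es k

    project-inKernel : ∀ w → All (_≈ 0#) (dots us (project w))
    project-inKernel w = All-≋ (Pw.transitive trans (dots-sub us w _)
        (sub-cong (Pw.refl refl) (dual (dots us w) (≡.trans (length-dots us w) us∼es))))
      (sub-self (dots us w))

    dots-shift : ∀ x ys → All (_≈ 0#) (dots us x) → length ys ≡ length us → dots us (λ k → x k + lc ys es k) ≋ ys
    dots-shift x ys x∈ker ys∼us = Pw.transitive trans (dots-add us x _)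
      (Pw.transitive trans (add-cong (Pw.refl refl) (dual ys (≡.trans ys∼us us∼es)))
                           (add-zeroˡ x∈ker (≡.trans (length-dots us x) (≡.sym ys∼us))))

    -- 𝔽ⁿ ≅ ker × 𝔽ᵐ via w ↦ (project w , dots us w).
    count-kernel : count (𝔽ⁿ-enum n) (λ cv → inKernelᵇ us ⟦ cv ⟧) ℕ.* q ℕ.^ length us ≡ q ℕ.^ n
    count-kernel = ≡.sym (≡.trans (≡.sym (total-𝔽ⁿ n)) (≡.trans bijection
      (≡.trans (count-× (𝔽ⁿ-enum n) (𝔽ⁿ-enum m) (λ cv → inKernelᵇ us ⟦ cv ⟧) (λ _ → true))
               (≡.cong (count (𝔽ⁿ-enum n) (λ cv → inKernelᵇ us ⟦ cv ⟧) ℕ.*_) (total-𝔽ⁿ m)))))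
      where
      m = length us
      coords : V n → Vec (Fin q) m
      coords w = proj₁ (codeFor (dots us w) m (length-dots us w))
      coords-correct : ∀ w → coeffs (coords w) ≋ dots us w
      coords-correct w = proj₂ (codeFor (dots us w) m (length-dots us w))
      InKernel : Vec (Fin q) n × Vec (Fin q) m → Bool
      InKernel p = inKernelᵇ us ⟦ proj₁ p ⟧ ∧ true
      split : Vec (Fin q) n → Vec (Fin q) n × Vec (Fin q) m
      split cw = encode (project ⟦ cw ⟧) , coords ⟦ cw ⟧
      join : Vec (Fin q) n × Vec (Fin q) m → Vec (Fin q) n
      join (cv , y) = encode (λ k → ⟦ cv ⟧ k + lc (coeffs y) es k)
      split-inKernel : ∀ cw → true ≡ true → InKernel (split cw) ≡ true
      split-inKernel cw _ = ∧≡true⁺ (dec-true (allZero? _) (All-≋ (dots-cong us (⟦encode⟧ (project ⟦ cw ⟧))) (project-inKernel ⟦ cw ⟧))) ≡.refl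
      join-split : ∀ cw → true ≡ true → join (split cw) ≡ cw
      join-split cw _ = encode-unique _ cw (λ k → trans
        (+-cong (⟦encode⟧ (project ⟦ cw ⟧) k) (lc-cong es (coords-correct ⟦ cw ⟧) k))
        (//-rightDividesˡ (lc (dots us ⟦ cw ⟧) es k) (⟦ cw ⟧ k)))
      split-join : ∀ p → InKernel p ≡ true → split (join p) ≡ p
      split-join (cv , y) h = ≡.cong₂ _,_ kernel-part coordinate-part
        where
        x : V n
        x k = ⟦ cv ⟧ k + lc (coeffs y) es k
        dots-x : dots us ⟦ encode x ⟧ ≋ coeffs y
        dots-x = Pw.transitive trans (dots-cong us (⟦encode⟧ x))
          (dots-shift ⟦ cv ⟧ (coeffs y) (does-true⁻ (allZero? _) (proj₁ (∧≡true⁻ h))) (length-coeffs y))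
        kernel-part : encode (project ⟦ encode x ⟧) ≡ cv
        kernel-part = encode-unique _ cv (λ k → trans
          (+-cong (⟦encode⟧ x k) (-‿cong (lc-cong es dots-x k)))
          (//-rightDividesʳ (lc (coeffs y) es k) (⟦ cv ⟧ k)))
        coordinate-part : coords ⟦ encode x ⟧ ≡ y
        coordinate-part = coeffs-inj _ y (Pw.transitive trans (coords-correct _) dots-x)
      bijection : count (𝔽ⁿ-enum n) (λ _ → true) ≡ count (×-enum (𝔽ⁿ-enum n) (𝔽ⁿ-enum m)) InKernel
      bijection = count-bijection (𝔽ⁿ-enum n) (×-enum (𝔽ⁿ-enum n) (𝔽ⁿ-enum m)) (λ _ → true) InKernel
        split join split-inKernel (λ _ _ → ≡.refl) join-split split-join

  dual₁ : ∀ {n} (u e : V n) → dot u e ≈ 1# → Dual (u ∷ []) (e ∷ [])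
  dual₁ u e u·e≈1 (y ∷ []) _ = (begin
      dot u (λ k → y * e k + 0#)      ≈⟨ dot-lin u e (λ _ → 0#) y ⟩
      y * dot u e + dot u (λ _ → 0#)  ≈⟨ +-cong (*-congˡ u·e≈1) (dot-zero u) ⟩
      y * 1# + 0#                     ≈⟨ trans (+-identityʳ _) (*-identityʳ y) ⟩
      y                               ∎) ∷ []

  dual₂ : ∀ {n} (u₁ u₂ e₁ e₂ : V n) → dot u₁ e₁ ≈ 1# → dot u₁ e₂ ≈ 0# → dot u₂ e₁ ≈ 0# → dot u₂ e₂ ≈ 1# →
    Dual (u₁ ∷ u₂ ∷ []) (e₁ ∷ e₂ ∷ [])
  dual₂ u₁ u₂ e₁ e₂ d₁₁ d₁₂ d₂₁ d₂₂ (y₁ ∷ y₂ ∷ []) _ = first ∷ second ∷ []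
    where
    L : V _
    L = lc (y₁ ∷ y₂ ∷ []) (e₁ ∷ e₂ ∷ [])
    expand : ∀ u → dot u L ≈ y₁ * dot u e₁ + (y₂ * dot u e₂ + 0#)
    expand u = trans (dot-lin u e₁ _ y₁) (+-congˡ (trans (dot-lin u e₂ (λ _ → 0#) y₂) (+-congˡ (dot-zero u))))
    first : dot u₁ L ≈ y₁
    first = trans (expand u₁) (trans (+-cong (*-congˡ d₁₁) (+-congʳ (*-congˡ d₁₂)))
      (trans (+-cong (*-identityʳ y₁) (trans (+-identityʳ _) (zeroʳ y₂))) (+-identityʳ y₁)))
    second : dot u₂ L ≈ y₂
    second = trans (expand u₂) (trans (+-cong (*-congˡ d₂₁) (+-congʳ (*-congˡ d₂₂)))
      (trans (+-cong (zeroʳ y₁) (+-identityʳ _)) (trans (+-identityˡ _) (*-identityʳ y₂))))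

  count-kernel₁ : ∀ {n} (u : V n) → ¬ IsZeroVec u →
    count (𝔽ⁿ-enum n) (λ cv → inKernelᵇ (u ∷ []) ⟦ cv ⟧) ℕ.* q ℕ.^ 1 ≡ q ℕ.^ n
  count-kernel₁ u u≉0 with dual-vector u u≉0
  ... | e , u·e≈1 = count-kernel (u ∷ []) (e ∷ []) ≡.refl (dual₁ u e u·e≈1)

  orthᵇ : ∀ {n} → V n → V n → Bool
  orthᵇ u w = does (dot u w ≟ 0#)

  orthᵇ-congʳ : ∀ {n} (u : V n) {w w' : V n} → (∀ k → w k ≈ w' k) → orthᵇ u w ≡ orthᵇ u w'
  orthᵇ-congʳ u w≈w' = does-≈0-cong (dot-congʳ u w≈w')

  orthᵇ-scaleʳ : ∀ {n} (u w : V n) s → ¬ (s ≈ 0#) → orthᵇ u (λ k → s * w k) ≡ orthᵇ u w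
  orthᵇ-scaleʳ u w s s≉0 = ≡.trans (does-≈0-cong (dot-scale u w s)) (does-≈0-scale s _ s≉0)

  orthᵇ-comm : ∀ {n} (u w : V n) → orthᵇ u w ≡ orthᵇ w u
  orthᵇ-comm u w = does-≈0-cong (dot-comm u w)

  _∉Line_ : ∀ {n} → V n → V n → Set (c ⊔ ℓ)
  w ∉Line u = ∀ s → ¬ (∀ k → w k ≈ s * u k)

  separates? : ∀ {n} → V n → V n → Vec (Fin q) n → Bool
  separates? u w cv = orthᵇ u ⟦ cv ⟧ ∧ not (orthᵇ w ⟦ cv ⟧)

  -- If no vector of u⊥ left w⊥, the vectors eₖ − uₖ e (for e dual to u) would force w = (w · e) u.
  separating-vector : ∀ {n} (u w : V n) → ¬ IsZeroVec u → w ∉Line u → Σ (V n) λ x → (dot u x ≈ 0#) × (dot w x ≈ 1#)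
  separating-vector {n} u w u≉0 w∉u with search (separates? u w) (elems (𝔽ⁿ-enum n))
  ... | inj₁ (cv , h) with ∧≡true⁻ {orthᵇ u ⟦ cv ⟧} h
  ...   | u⊥x , w-not-⊥x with inverse (dot w ⟦ cv ⟧) (λ z → case ≡.trans (≡.sym (not≡true⁻ w-not-⊥x)) (≈⇒does z) of λ ())
  ...     | s , w·x*s≈1 = (λ k → s * ⟦ cv ⟧ k)
                          , trans (dot-scale u ⟦ cv ⟧ s) (trans (*-congˡ (does⇒≈ u⊥x)) (zeroʳ s))
                          , trans (dot-scale w ⟦ cv ⟧ s) (trans (*-comm _ _) w·x*s≈1)
  separating-vector {n} u w u≉0 w∉u | inj₂ none with dual-vector u u≉0
  ... | e , u·e≈1 = ⊥-elim (w∉u (dot w e) w≈[w·e]u)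
    where
    x : Fin n → V n
    x k i = stdBasis k i + - (u k * e i)
    dot-x : ∀ y k → dot y (x k) ≈ y k + - (u k * dot y e)
    dot-x y k = trans (dot-sub y (stdBasis k) (λ i → u k * e i)) (+-cong (dot-stdBasis y k) (-‿cong (dot-scale y e (u k))))
    u⊥x : ∀ k → dot u (x k) ≈ 0#
    u⊥x k = trans (dot-x u k) (trans (+-congˡ (-‿cong (trans (*-congˡ u·e≈1) (*-identityʳ _)))) (-‿inverseʳ _))
    w⊥x : ∀ k → dot w (x k) ≈ 0#
    w⊥x k with dot w ⟦ encode (x k) ⟧ ≟ 0#
    ... | yes w·x≈0 = trans (dot-congʳ w (λ i → sym (⟦encode⟧ (x k) i))) w·x≈0
    ... | no w·x≉0 = ⊥-elim (all-false⇒¬true (𝔽ⁿ-enum n) (separates? u w) none (encode (x k))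
                    (∧≡true⁺ (≈⇒does (trans (dot-congʳ u (⟦encode⟧ (x k))) (u⊥x k))) (not≡true⁺ (≉⇒¬does w·x≉0))))
    w≈[w·e]u : ∀ k → w k ≈ dot w e * u k
    w≈[w·e]u k = trans (x-y≈0⇒x≈y _ _ (trans (sym (dot-x w k)) (w⊥x k))) (*-comm _ _)

  count-kernel₂ : ∀ {n} (u w : V n) → ¬ IsZeroVec u → ¬ IsZeroVec w → w ∉Line u → u ∉Line w →
    count (𝔽ⁿ-enum n) (λ cv → inKernelᵇ (u ∷ w ∷ []) ⟦ cv ⟧) ℕ.* q ℕ.^ 2 ≡ q ℕ.^ n
  count-kernel₂ u w u≉0 w≉0 w∉u u∉w with separating-vector w u w≉0 u∉w | separating-vector u w u≉0 w∉u
  ... | e₁ , w·e₁≈0 , u·e₁≈1 | e₂ , u·e₂≈0 , w·e₂≈1 =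
    count-kernel (u ∷ w ∷ []) (e₁ ∷ e₂ ∷ []) ≡.refl (dual₂ u w e₁ e₂ u·e₁≈1 u·e₂≈0 w·e₁≈0 w·e₂≈1)

module LineEnumeration {c ℓ} (𝔽 : FiniteField c ℓ) {N n : ℕ}
  (v : Fin N → LinAlg.Vecⁿ 𝔽 n) (isLines : LinAlg.IsLineEnumeration 𝔽 v) where

  open FiniteField 𝔽
  open CommutativeRing commRing
  open Counting
  open Orthogonality 𝔽 public
  open import Level using (_⊔_)
  open import Data.Nat as ℕ using (ℕ; zero)
  open import Data.Bool using (Bool; true; false; _∧_; not)
  open import Data.Bool.Properties using (∧-identityʳ; ∧-zeroʳ)
  open import Data.List using (List; []; _∷_; length)
  open import Data.List.Relation.Unary.All using ([]; _∷_)
  open import Data.Fin using (Fin)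
  open import Data.Vec using (Vec)
  open import Data.Product using (∃; _×_; _,_; proj₁; proj₂)
  open import Data.Empty using (⊥-elim)
  open import Function using (case_of_)
  open import Relation.Nullary using (¬_; Dec; yes; no)
  open import Relation.Binary.PropositionalEquality as ≡ using (_≡_)

  v-nonzero : ∀ i → ¬ IsZeroVec (v i)
  v-nonzero = proj₁ isLines

  v-injective : ∀ i j (s : Carrier) → (∀ k → v i k ≈ s * v j k) → i ≡ j
  v-injective = proj₁ (proj₂ isLines)

  v-covers : ∀ (w : V n) → ¬ IsZeroVec w → ∃ λ i → ∃ λ (s : Carrier) → ∀ k → w k ≈ s * v i k
  v-covers = proj₂ (proj₂ isLines)

  lines : Enum (Fin N)
  lines = finEnum N

  distinct-lines : ∀ i j → ¬ i ≡ j → v j ∉Line v i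
  distinct-lines i j i≢j s vj≈s·vi = i≢j (≡.sym (v-injective j i s vj≈s·vi))

  scaled-line-injective : ∀ i i' (s s' : Fin q) → ¬ (enum s ≈ 0#) →
    (∀ k → enum s * v i k ≈ enum s' * v i' k) → (i ≡ i') × (s ≡ s')
  scaled-line-injective i i' s s' s≉0 same with inverse (enum s) s≉0
  ... | t , s*t≈1 = i≡i' , s≡s'
    where
    open import Relation.Binary.Reasoning.Setoid setoid
    i≡i' : i ≡ i'
    i≡i' = v-injective i i' (t * enum s') (λ k → begin
        v i k                       ≈⟨ sym (*-identityˡ _) ⟩
        1# * v i k                  ≈⟨ *-congʳ (sym (trans (*-comm t _) s*t≈1)) ⟩
        (t * enum s) * v i k        ≈⟨ *-assoc _ _ _ ⟩
        t * (enum s * v i k)        ≈⟨ *-congˡ (same k) ⟩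
        t * (enum s' * v i' k)      ≈⟨ sym (*-assoc _ _ _) ⟩
        (t * enum s') * v i' k      ∎)
    s≡s' : s ≡ s'
    s≡s' with nonzero-entry (v i) (v-nonzero i)
    ... | j , vij≉0 = enum-inj _ _ (*-cancelʳ-≉0 (enum s) (enum s') (v i j) vij≉0
                        (trans (same j) (*-congˡ (reflexive (≡.cong (λ l → v l j) (≡.sym i≡i'))))))

  Indep-line : ∀ i → Indep (v i ∷ [])
  Indep-line i (a ∷ []) _ a·vi≈0 with nonzero-entry (v i) (v-nonzero i)
  ... | k , vik≉0 = *-cancelʳ-≉0 a 0# (v i k) vik≉0 (trans (trans (sym (+-identityʳ _)) (a·vi≈0 k)) (sym (zeroˡ _))) ∷ []

  Indep-two-lines : ∀ i j → ¬ i ≡ j → Indep (v i ∷ v j ∷ [])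
  Indep-two-lines i j i≢j = Indep-snoc (v i ∷ []) (v j) (Indep-line i) vj∉⟨vi⟩
    where
    vj∉⟨vi⟩ : ¬ InSpan (v i ∷ []) (v j)
    vj∉⟨vi⟩ (a ∷ [] , _ , e) = distinct-lines i j i≢j a (λ k → sym (trans (sym (+-identityʳ _)) (e k)))

  -- The default line i₀ is returned only for the zero vector, to make the map total.
  toLine : Fin N → (w : V n) → Dec (IsZeroVec w) → Fin N × Fin q
  toLine i₀ w (yes _)   = i₀ , code 0#
  toLine i₀ w (no w≉0) = proj₁ (v-covers w w≉0) , code (proj₁ (proj₂ (v-covers w w≉0)))

  toLine-correct : ∀ i₀ w (d : Dec (IsZeroVec w)) → ¬ IsZeroVec w →
    ∀ k → w k ≈ enum (proj₂ (toLine i₀ w d)) * v (proj₁ (toLine i₀ w d)) k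
  toLine-correct i₀ w (yes w≈0) w≉0 = ⊥-elim (w≉0 w≈0)
  toLine-correct i₀ w (no w≉0)  _   k = trans (proj₂ (proj₂ (v-covers w w≉0)) k) (*-congʳ (sym (code-correct _)))

  record Projective (S : V n → Bool) : Set (c ⊔ ℓ) where
    field
      respects-≈      : ∀ w w' → (∀ k → w k ≈ w' k) → S w ≡ S w'
      scale-invariant : ∀ w s → ¬ (s ≈ 0#) → S (λ k → s * w k) ≡ S w
      excludes-0      : S (λ _ → 0#) ≡ false

  -- Each line carries q − 1 nonzero vectors.
  count-lines : (i₀ : Fin N) (S : V n → Bool) → Projective S →
    count lines (λ i → S (v i)) ℕ.* count 𝔽-enum nonzeroᵇ ≡ count (𝔽ⁿ-enum n) (λ cv → S ⟦ cv ⟧)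
  count-lines i₀ S proj = ≡.trans (≡.sym (count-× lines 𝔽-enum (λ i → S (v i)) nonzeroᵇ)) bijection
    where
    open Projective proj
    OnLine : Fin N × Fin q → Bool
    OnLine (i , s) = S (v i) ∧ nonzeroᵇ s
    nonzero-code : ∀ s → nonzeroᵇ s ≡ true → ¬ (enum s ≈ 0#)
    nonzero-code s h s≈0 = case ≡.trans (≡.sym (not≡true⁻ h)) (≈⇒does s≈0) of λ ()
    S⇒nonzero : ∀ w → S w ≡ true → ¬ IsZeroVec w
    S⇒nonzero w Sw w≈0 = case ≡.trans (≡.sym Sw) (≡.trans (respects-≈ w _ w≈0) excludes-0) of λ ()
    toVec : Fin N × Fin q → Vec (Fin q) n
    toVec (i , s) = encode (λ k → enum s * v i k)
    fromVec : Vec (Fin q) n → Fin N × Fin q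
    fromVec cv = toLine i₀ ⟦ cv ⟧ (isZero? ⟦ cv ⟧)
    fromVec-correct : ∀ cv → S ⟦ cv ⟧ ≡ true → ∀ k → ⟦ cv ⟧ k ≈ enum (proj₂ (fromVec cv)) * v (proj₁ (fromVec cv)) k
    fromVec-correct cv Scv = toLine-correct i₀ ⟦ cv ⟧ (isZero? ⟦ cv ⟧) (S⇒nonzero ⟦ cv ⟧ Scv)
    toVec-S : ∀ p → OnLine p ≡ true → S ⟦ toVec p ⟧ ≡ true
    toVec-S (i , s) h with ∧≡true⁻ {S (v i)} h
    ... | Svi , s≉0 = ≡.trans (respects-≈ _ _ (⟦encode⟧ _))
                        (≡.trans (scale-invariant (v i) (enum s) (nonzero-code s s≉0)) Svi)
    fromVec-OnLine : ∀ cv → S ⟦ cv ⟧ ≡ true → OnLine (fromVec cv) ≡ true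
    fromVec-OnLine cv Scv = ∧≡true⁺
      (≡.trans (≡.sym (scale-invariant _ _ s≉0)) (≡.trans (≡.sym (respects-≈ _ _ (fromVec-correct cv Scv))) Scv))
      (not≡true⁺ (≉⇒¬does s≉0))
      where
      s≉0 : ¬ (enum (proj₂ (fromVec cv)) ≈ 0#)
      s≉0 s≈0 = S⇒nonzero ⟦ cv ⟧ Scv (λ k → trans (fromVec-correct cv Scv k) (trans (*-congʳ s≈0) (zeroˡ _)))
    fromVec-toVec : ∀ p → OnLine p ≡ true → fromVec (toVec p) ≡ p
    fromVec-toVec (i , s) h with scaled-line-injective i _ s _ (nonzero-code s (proj₂ (∧≡true⁻ {S (v i)} h)))
      (λ k → trans (sym (⟦encode⟧ _ k)) (fromVec-correct (toVec (i , s)) (toVec-S (i , s) h) k))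
    ... | i≡i' , s≡s' = ≡.sym (≡.cong₂ _,_ i≡i' s≡s')
    toVec-fromVec : ∀ cv → S ⟦ cv ⟧ ≡ true → toVec (fromVec cv) ≡ cv
    toVec-fromVec cv Scv = encode-unique _ cv (λ k → sym (fromVec-correct cv Scv k))
    bijection : count (×-enum lines 𝔽-enum) OnLine ≡ count (𝔽ⁿ-enum n) (λ cv → S ⟦ cv ⟧)
    bijection = count-bijection (×-enum lines 𝔽-enum) (𝔽ⁿ-enum n) OnLine (λ cv → S ⟦ cv ⟧)
      toVec fromVec toVec-S fromVec-OnLine fromVec-toVec toVec-fromVec

  ABᵇ : Fin N → Fin N → V n → Bool
  ABᵇ i j w = orthᵇ (v i) w ∧ not (orthᵇ w (v j))

  ABᵇ-projective : ∀ i j → Projective (ABᵇ i j)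
  ABᵇ-projective i j = record
    { respects-≈      = λ w w' w≈w' → ≡.cong₂ (λ a b → a ∧ not b) (orthᵇ-congʳ (v i) w≈w') (flipped w≈w')
    ; scale-invariant = λ w s s≉0 → ≡.cong₂ (λ a b → a ∧ not b) (orthᵇ-scaleʳ (v i) w s s≉0)
        (≡.trans (orthᵇ-comm _ (v j)) (≡.trans (orthᵇ-scaleʳ (v j) w s s≉0) (orthᵇ-comm (v j) w)))
    ; excludes-0      = ≡.trans (≡.cong (λ b → orthᵇ (v i) (λ _ → 0#) ∧ not b)
        (≡.trans (orthᵇ-comm _ (v j)) (≈⇒does (dot-zero (v j))))) (∧-zeroʳ _)
    }
    where
    flipped : ∀ {w w'} → (∀ k → w k ≈ w' k) → orthᵇ w (v j) ≡ orthᵇ w' (v j)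
    flipped {w} {w'} w≈w' = ≡.trans (orthᵇ-comm w (v j)) (≡.trans (orthᵇ-congʳ (v j) w≈w') (orthᵇ-comm (v j) w'))

  count-AB-lines : ∀ i j →
    count (𝔽ⁿ-enum n) (λ cv → inKernelᵇ (v i ∷ v j ∷ []) ⟦ cv ⟧) ℕ.+ count lines (λ k → ABᵇ i j (v k)) ℕ.* count 𝔽-enum nonzeroᵇ
      ≡ count (𝔽ⁿ-enum n) (λ cv → inKernelᵇ (v i ∷ []) ⟦ cv ⟧)
  count-AB-lines i j = begin
      count (𝔽ⁿ-enum n) (λ cv → inKernelᵇ (v i ∷ v j ∷ []) ⟦ cv ⟧) ℕ.+ count lines (λ k → ABᵇ i j (v k)) ℕ.* count 𝔽-enum nonzeroᵇ
    ≡⟨ ≡.cong₂ ℕ._+_ (count-cong (𝔽ⁿ-enum n) _ _ kernel₂) (count-lines i (ABᵇ i j) (ABᵇ-projective i j)) ⟩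
      count (𝔽ⁿ-enum n) (λ cv → ⊥vᵢ cv ∧ orthᵇ ⟦ cv ⟧ (v j)) ℕ.+ count (𝔽ⁿ-enum n) (λ cv → ⊥vᵢ cv ∧ not (orthᵇ ⟦ cv ⟧ (v j)))
    ≡⟨ ≡.sym (count-split (𝔽ⁿ-enum n) ⊥vᵢ (λ cv → orthᵇ ⟦ cv ⟧ (v j))) ⟩
      count (𝔽ⁿ-enum n) ⊥vᵢ
    ≡⟨ count-cong (𝔽ⁿ-enum n) _ _ (λ cv → ≡.sym (∧-identityʳ _)) ⟩
      count (𝔽ⁿ-enum n) (λ cv → inKernelᵇ (v i ∷ []) ⟦ cv ⟧)
    ∎
    where
    open ≡.≡-Reasoning
    ⊥vᵢ : Vec (Fin q) n → Bool
    ⊥vᵢ cv = orthᵇ (v i) ⟦ cv ⟧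
    kernel₂ : ∀ cv → inKernelᵇ (v i ∷ v j ∷ []) ⟦ cv ⟧ ≡ ⊥vᵢ cv ∧ orthᵇ ⟦ cv ⟧ (v j)
    kernel₂ cv = ≡.cong (⊥vᵢ cv ∧_) (≡.trans (∧-identityʳ _) (orthᵇ-comm (v j) ⟦ cv ⟧))

  outside-span-projective : ∀ (ws : List (V n)) → Projective (λ w → not (inSpanᵇ ws w))
  outside-span-projective ws = record
    { respects-≈      = λ w w' w≈w' → ≡.cong not (inSpanᵇ-cong ws w w' w≈w')
    ; scale-invariant = λ w s s≉0 → ≡.cong not (inSpanᵇ-scale ws w s s≉0)
    ; excludes-0      = ≡.cong not (inSpanᵇ-complete ws _ (InSpan-zero ws))
    }

  count-lines-outside-span : (i₀ : Fin N) (ws : List (V n)) → Indep ws →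
    q ℕ.^ length ws ℕ.+ count lines (λ k → not (inSpanᵇ ws (v k))) ℕ.* count 𝔽-enum nonzeroᵇ ≡ q ℕ.^ n
  count-lines-outside-span i₀ ws ind =
    ≡.trans (≡.cong₂ ℕ._+_ (≡.sym (count-span ws ind)) (count-lines i₀ _ (outside-span-projective ws)))
      (≡.trans (≡.sym (count-split (𝔽ⁿ-enum n) (λ _ → true) (λ cv → inSpanᵇ ws ⟦ cv ⟧))) (total-𝔽ⁿ n))

module BasisExtensions {c ℓ} (𝔽 : FiniteField c ℓ) {N n : ℕ}
  (v : Fin N → LinAlg.Vecⁿ 𝔽 n) (isLines : LinAlg.IsLineEnumeration 𝔽 v) (i₀ : Fin N) where

  open FiniteField 𝔽
  open Counting
  open LineEnumeration 𝔽 v isLines public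
  open Subsets (Data.Fin.Properties._≟_ {N}) public
  open QAnalogues using (completions)
  open import Data.Nat as ℕ using (ℕ; zero; suc; _!)
  open import Data.Nat.Properties using (+-identityʳ; *-identityʳ; m+n∸m≡n; +-comm)
  open import Data.Nat.Tactic.RingSolver using (solve-∀)
  open import Data.Bool using (true; false; not)
  open import Data.List using (List; []; _∷_; map; _++_; length; allFin)
  open import Data.List.Properties using (map-++; ++-assoc; ++-identityʳ; length-++)
  open import Data.List.Relation.Unary.Any using (Any; here; there)
  open import Data.Vec using (toList)
  open import Data.Product using (_,_)
  open import Function using (id)
  open import Relation.Nullary using (¬_; yes; no)
  open import Relation.Binary.PropositionalEquality as ≡ using (_≡_)

  allLines : List (Fin N)
  allLines = allFin N

  allLines-Nodup : Nodup allLines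
  allLines-Nodup = tabulate-Nodup id (λ _ _ e → e)

  mem-allLines : ∀ x → mem x allLines ≡ true
  mem-allLines = mem-tabulate id

  #𝔽ˣ : ℕ
  #𝔽ˣ = count 𝔽-enum nonzeroᵇ

  extends : List (V n) → List (Fin N) → ℕ
  extends P t = 𝟙 (indepᵇ (P ++ map v t))

  #extensions : List (V n) → ℕ → ℕ
  #extensions P m = sumL (λ t → extends P (toList t)) (choose m allLines)

  extends-swap : ∀ P → SwapInvariant (extends P)
  extends-swap P u x y s = ≡.cong 𝟙 (≡.trans (≡.cong indepᵇ (reassociate x y))
    (≡.trans (indepᵇ-swap (P ++ map v u) (v x) (v y) (map v s)) (≡.sym (≡.cong indepᵇ (reassociate y x)))))
    where
    reassociate : ∀ a b → P ++ map v (u ++ a ∷ b ∷ s) ≡ (P ++ map v u) ++ v a ∷ v b ∷ map v s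
    reassociate a b = ≡.trans (≡.cong (P ++_) (map-++ v u (a ∷ b ∷ s))) (≡.sym (++-assoc P (map v u) _))

  mem⇒Any : ∀ x t → mem x t ≡ true → Any (_≡ v x) (map v t)
  mem⇒Any x (y ∷ t) x∈t with x Data.Fin.Properties.≟ y
  ... | yes ≡.refl = here ≡.refl
  ... | no _       = there (mem⇒Any x t x∈t)

  indepᵇ-repeat : ∀ (P : List (V n)) x t → mem x t ≡ true → indepᵇ (P ++ v x ∷ map v t) ≡ false
  indepᵇ-repeat P x t x∈t = indepᵇ-false _ (¬Indep-duplicate P (v x) (map v t) (mem⇒Any x t x∈t))

  #extensions-dependent : ∀ P → indepᵇ P ≡ false → ∀ m → #extensions P m ≡ 0
  #extensions-dependent P dep m =
    ≡.trans (sumL-cong (choose m allLines) (λ t → ≡.cong 𝟙 (indepᵇ-++ P _ dep))) (sumL-zero (choose m allLines))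

  extends-∷ : ∀ P x t → 𝟙 (not (mem x t)) ℕ.* extends P (x ∷ t) ≡ extends (P ++ v x ∷ []) t
  extends-∷ P x t with mem x t in x∈t
  ... | false = ≡.trans (+-identityʳ _) (≡.cong (λ l → 𝟙 (indepᵇ l)) (≡.sym (++-assoc P (v x ∷ []) (map v t))))
  ... | true  = ≡.sym (≡.cong 𝟙 (≡.trans (≡.cong indepᵇ (++-assoc P (v x ∷ []) (map v t))) (indepᵇ-repeat P x t x∈t)))

  -- Double counting the pairs (x, T) with x ∈ T.
  #extensions-suc : ∀ P k → suc k ℕ.* #extensions P (suc k) ≡ sumL (λ x → #extensions (P ++ v x ∷ []) k) allLines
  #extensions-suc P k = ≡.trans (≡.sym (double-counting allLines allLines-Nodup (suc k) (extends P)))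
    (sumL-cong allLines (λ x → ≡.trans (sumL-choose-∋ allLines allLines-Nodup k (extends P) (extends-swap P) x (mem-allLines x))
                                       (sumL-cong (choose k allLines) (λ t → extends-∷ P x (toList t)))))

  #lines-outside-span : ∀ P → Indep P → count lines (λ x → not (inSpanᵇ P (v x))) ℕ.* #𝔽ˣ ≡ q ℕ.^ n ℕ.∸ q ℕ.^ length P
  #lines-outside-span P ind = ≡.sym (≡.trans (≡.cong (ℕ._∸ q ℕ.^ length P) (≡.sym (count-lines-outside-span i₀ P ind)))
                                             (m+n∸m≡n (q ℕ.^ length P) _))

  -- Ordering the m new lines and choosing a nonzero vector on each gives the ordered completions.
  #extensions-count : ∀ m P → Indep P → #extensions P m ℕ.* (m ! ℕ.* #𝔽ˣ ℕ.^ m) ≡ completions q n (length P) m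
  #extensions-count zero P ind =
    ≡.trans (*-identityʳ _) (≡.trans (+-identityʳ _) (≡.cong 𝟙 (≡.trans (≡.cong indepᵇ (++-identityʳ P)) (indepᵇ-complete P ind))))
  #extensions-count (suc k) P ind = begin
      #extensions P (suc k) ℕ.* (suc k ! ℕ.* #𝔽ˣ ℕ.^ suc k)
    ≡⟨ regroup (#extensions P (suc k)) (suc k) (k !) #𝔽ˣ (#𝔽ˣ ℕ.^ k) ⟩
      #𝔽ˣ ℕ.* ((suc k ℕ.* #extensions P (suc k)) ℕ.* K)
    ≡⟨ ≡.cong (λ z → #𝔽ˣ ℕ.* (z ℕ.* K)) (#extensions-suc P k) ⟩
      #𝔽ˣ ℕ.* (sumL (λ x → #extensions (P ++ v x ∷ []) k) allLines ℕ.* K)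
    ≡⟨ ≡.cong (#𝔽ˣ ℕ.*_) (≡.sym (sumL-*ʳ K (λ x → #extensions (P ++ v x ∷ []) k) allLines)) ⟩
      #𝔽ˣ ℕ.* sumL (λ x → #extensions (P ++ v x ∷ []) k ℕ.* K) allLines
    ≡⟨ ≡.cong (#𝔽ˣ ℕ.*_) (sumL-cong allLines extend-by) ⟩
      #𝔽ˣ ℕ.* sumL (λ x → 𝟙 (not (inSpanᵇ P (v x))) ℕ.* C) allLines
    ≡⟨ ≡.cong (#𝔽ˣ ℕ.*_) (sumL-*ʳ C (λ x → 𝟙 (not (inSpanᵇ P (v x)))) allLines) ⟩
      #𝔽ˣ ℕ.* (count lines (λ x → not (inSpanᵇ P (v x))) ℕ.* C)
    ≡⟨ swap-outer #𝔽ˣ (count lines (λ x → not (inSpanᵇ P (v x)))) C ⟩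
      (count lines (λ x → not (inSpanᵇ P (v x))) ℕ.* #𝔽ˣ) ℕ.* C
    ≡⟨ ≡.cong (ℕ._* C) (#lines-outside-span P ind) ⟩
      (q ℕ.^ n ℕ.∸ q ℕ.^ length P) ℕ.* C
    ∎
    where
    open ≡.≡-Reasoning
    K = k ! ℕ.* #𝔽ˣ ℕ.^ k
    C = completions q n (suc (length P)) k
    regroup : ∀ g s f c ck → g ℕ.* ((s ℕ.* f) ℕ.* (c ℕ.* ck)) ≡ c ℕ.* ((s ℕ.* g) ℕ.* (f ℕ.* ck))
    regroup = solve-∀
    swap-outer : ∀ a b d → a ℕ.* (b ℕ.* d) ≡ (b ℕ.* a) ℕ.* d
    swap-outer = solve-∀
    length-snoc : ∀ x → length (P ++ v x ∷ []) ≡ suc (length P)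
    length-snoc x = ≡.trans (length-++ P) (+-comm (length P) 1)
    extend-by : ∀ x → #extensions (P ++ v x ∷ []) k ℕ.* K ≡ 𝟙 (not (inSpanᵇ P (v x))) ℕ.* C
    extend-by x with indepᵇ (P ++ v x ∷ []) in e
    ... | true  = ≡.trans (#extensions-count k (P ++ v x ∷ []) (indepᵇ-sound _ e))
                    (≡.trans (≡.cong (λ l → completions q n l k) (length-snoc x)) (≡.trans (≡.sym (+-identityʳ _))
                      (≡.cong (λ b → 𝟙 b ℕ.* C) (≡.trans (≡.sym e) (indepᵇ-snoc P ind (v x))))))
    ... | false = ≡.trans (≡.cong (ℕ._* K) (#extensions-dependent _ e k))
                    (≡.cong (λ b → 𝟙 b ℕ.* C) (≡.trans (≡.sym e) (indepᵇ-snoc P ind (v x))))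

  throughᵇ : Fin N → Fin N → List (Fin N) → ℕ
  throughᵇ i j t = 𝟙 (mem i t) ℕ.* (𝟙 (mem j t) ℕ.* 𝟙 (indepᵇ (map v t)))

  #basesThrough : Fin N → Fin N → ℕ → ℕ
  #basesThrough i j m = sumL (λ t → throughᵇ i j (toList t)) (choose (suc (suc m)) allLines)

  #basesThrough≡#extensions : ∀ i j m → ¬ i ≡ j → #basesThrough i j m ≡ #extensions (v i ∷ v j ∷ []) m
  #basesThrough≡#extensions i j m i≢j =
    ≡.trans (sumL-choose-∋ allLines allLines-Nodup (suc m) with-j with-j-swap i (mem-allLines i))
   (≡.trans (sumL-cong (choose (suc m) allLines) remove-i)
   (≡.trans (sumL-choose-∋ allLines allLines-Nodup m after-i after-i-swap j (mem-allLines j))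
            (sumL-cong (choose m allLines) (λ s → remove-j (toList s)))))
    where
    with-j : List (Fin N) → ℕ
    with-j t = 𝟙 (mem j t) ℕ.* extends [] t
    with-j-swap : SwapInvariant with-j
    with-j-swap u x y s = ≡.cong₂ (λ a b → 𝟙 a ℕ.* b) (mem-swap j u x y s) (extends-swap [] u x y s)
    after-i : List (Fin N) → ℕ
    after-i t = 𝟙 (not (mem i t)) ℕ.* extends (v i ∷ []) t
    after-i-swap : SwapInvariant after-i
    after-i-swap u x y s = ≡.cong₂ (λ a b → 𝟙 (not a) ℕ.* b) (mem-swap i u x y s) (extends-swap (v i ∷ []) u x y s)
    commute : ∀ a b d → a ℕ.* (b ℕ.* d) ≡ b ℕ.* (a ℕ.* d)
    commute = solve-∀
    remove-i : ∀ t → 𝟙 (not (mem i (toList t))) ℕ.* with-j (i ∷ toList t) ≡ 𝟙 (mem j (toList t)) ℕ.* after-i (toList t)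
    remove-i t = ≡.trans
      (≡.cong (λ b → 𝟙 (not (mem i (toList t))) ℕ.* (𝟙 b ℕ.* 𝟙 (indepᵇ (v i ∷ map v (toList t)))))
              (mem-there j i (toList t) (λ e → i≢j (≡.sym e))))
      (commute (𝟙 (not (mem i (toList t)))) (𝟙 (mem j (toList t))) (𝟙 (indepᵇ (v i ∷ map v (toList t)))))
    remove-j : ∀ s → 𝟙 (not (mem j s)) ℕ.* after-i (j ∷ s) ≡ extends (v i ∷ v j ∷ []) s
    remove-j s rewrite mem-there i j s i≢j with mem j s in j∈s
    ... | true  = ≡.sym (≡.cong 𝟙 (indepᵇ-repeat (v i ∷ []) j s j∈s))
    ... | false with mem i s in i∈s
    ...   | true  = ≡.sym (≡.cong 𝟙 (indepᵇ-repeat [] i (j ∷ s) (≡.trans (mem-there i j s i≢j) i∈s)))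
    ...   | false = ≡.trans (+-identityʳ _) (+-identityʳ _)

  #basesThrough-count : ∀ i j m → ¬ i ≡ j → #basesThrough i j m ℕ.* (m ! ℕ.* #𝔽ˣ ℕ.^ m) ≡ completions q n 2 m
  #basesThrough-count i j m i≢j = ≡.trans (≡.cong (ℕ._* (m ! ℕ.* #𝔽ˣ ℕ.^ m)) (#basesThrough≡#extensions i j m i≢j))
                                          (#extensions-count m (v i ∷ v j ∷ []) (Indep-two-lines i j i≢j))

module HessianEvaluation {c ℓ} (R : CommutativeRing c ℓ) (N : ℕ) where

  open CommutativeRing R
  open RingOps R
  open RingSums R
  open Poly R N
  open Counting using (sumL)
  open import Data.Nat as ℕ using (zero; suc; _∸_)
  open import Data.Bool using (Bool; true; false; if_then_else_)
  open import Data.List using ([]; _∷_; _++_; concatMap)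
  open import Data.List.Properties using (map-concatMap)
  open import Data.Fin using () renaming (zero to fz; suc to fs)
  open import Data.Fin.Properties using () renaming (_≟_ to _≟F_)
  open import Relation.Nullary using (does)
  open import Relation.Binary.PropositionalEquality as ≡ using (_≡_)
  open import Relation.Binary.Reasoning.Setoid setoid

  𝟏 : Fin N → Carrier
  𝟏 _ = 1#

  eval-++ : ∀ xs ys → eval 𝟏 (xs ++ ys) ≈ eval 𝟏 xs + eval 𝟏 ys
  eval-++ []              ys = sym (+-identityˡ _)
  eval-++ (term a e ∷ xs) ys = trans (+-congˡ (eval-++ xs ys)) (sym (+-assoc _ _ _))

  eval-concatMap : ∀ {A : Set} (h : A → Polynomial) (value : A → ℕ) → (∀ t → eval 𝟏 (h t) ≈ fromℕ (value t)) →
    ∀ ts → eval 𝟏 (concatMap h ts) ≈ fromℕ (sumL value ts)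
  eval-concatMap h value ok []       = refl
  eval-concatMap h value ok (t ∷ ts) = trans (eval-++ (h t) (concatMap h ts))
    (trans (+-cong (ok t) (eval-concatMap h value ok ts)) (sym (fromℕ-+ (value t) _)))

  ∂∂-concatMap : ∀ {A : Set} i j (g : A → Polynomial) ts → ∂ i (∂ j (concatMap g ts)) ≡ concatMap (λ t → ∂ i (∂ j (g t))) ts
  ∂∂-concatMap i j g ts = ≡.trans (≡.cong (∂ i) (map-concatMap _ g ts)) (map-concatMap _ (λ t → ∂ j (g t)) ts)

  1^ : ∀ k → 1# ^ k ≈ 1#
  1^ zero    = refl
  1^ (suc k) = trans (*-identityˡ _) (1^ k)

  ∏-1^ : ∀ {m} (f : Fin m → ℕ) → ∏ (λ x → 1# ^ f x) ≈ 1#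
  ∏-1^ {zero}  f = refl
  ∏-1^ {suc m} f = trans (*-cong (1^ (f fz)) (∏-1^ (λ x → f (fs x)))) (*-identityˡ 1#)

  lowered : Fin N → (Fin N → ℕ) → Fin N → ℕ
  lowered j e x = if does (x ≟F j) then e x ∸ 1 else e x

  ∂∂-monomial : ∀ i j (b : Bool) (e : Fin N → ℕ) →
    eval 𝟏 (∂ i (∂ j (if b then term 1# e ∷ [] else []))) ≈ fromℕ (if b then lowered j e i ℕ.* e j else 0)
  ∂∂-monomial i j false e = refl
  ∂∂-monomial i j true  e = begin
      (fromℕ (lowered j e i) * (fromℕ (e j) * 1#)) * ∏ (λ x → 1# ^ lowered i (lowered j e) x) + 0#
        ≈⟨ +-identityʳ _ ⟩
      (fromℕ (lowered j e i) * (fromℕ (e j) * 1#)) * ∏ (λ x → 1# ^ lowered i (lowered j e) x)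
        ≈⟨ *-cong (*-congˡ (*-identityʳ _)) (∏-1^ (lowered i (lowered j e))) ⟩
      (fromℕ (lowered j e i) * fromℕ (e j)) * 1#
        ≈⟨ *-identityʳ _ ⟩
      fromℕ (lowered j e i) * fromℕ (e j)
        ≈⟨ sym (fromℕ-* (lowered j e i) (e j)) ⟩
      fromℕ (lowered j e i ℕ.* e j)
        ∎

  hessian-at-1 : ∀ {A : Set} (bs : A → Bool) (es : A → Fin N → ℕ) ts i j →
    eval 𝟏 (∂ i (∂ j (concatMap (λ t → if bs t then term 1# (es t) ∷ [] else []) ts)))
      ≈ fromℕ (sumL (λ t → if bs t then lowered j (es t) i ℕ.* es t j else 0) ts)
  hessian-at-1 bs es ts i j = trans (reflexive (≡.cong (eval 𝟏) (∂∂-concatMap i j _ ts)))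
    (eval-concatMap _ _ (λ t → ∂∂-monomial i j (bs t) (es t)) ts)

module FieldFacts {c ℓ} (K : Field c ℓ) where

  open Field K
  open CommutativeRing commRing
  open RingOps commRing
  open RingSums commRing
  open Counting using (𝟙)
  open import Data.Nat as ℕ using ()
  open import Data.Bool using (true; false; if_then_else_; _∧_; not)
  open import Relation.Nullary using (¬_)
  open import Relation.Binary.PropositionalEquality as ≡ using (_≡_)
  open import Relation.Binary.Reasoning.Setoid setoid
  open import Algebra.Properties.Group +-group using (ε⁻¹≈ε)

  fromℕ-quotient : ∀ h t a d → h ℕ.* d ≡ t ℕ.* a → ¬ (fromℕ d ≈ 0#) → fromℕ h ≈ (fromℕ t * fromℕ d ⁻¹) * fromℕ a
  fromℕ-quotient h t a d hd≡ta d≉0 = begin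
      fromℕ h                                ≈⟨ sym (*-identityʳ _) ⟩
      fromℕ h * 1#                           ≈⟨ *-congˡ (sym (inverseʳ _ d≉0)) ⟩
      fromℕ h * (fromℕ d * fromℕ d ⁻¹)       ≈⟨ sym (*-assoc _ _ _) ⟩
      (fromℕ h * fromℕ d) * fromℕ d ⁻¹       ≈⟨ *-congʳ (trans (sym (fromℕ-* h d)) (trans (reflexive (≡.cong fromℕ hd≡ta)) (fromℕ-* t a))) ⟩
      (fromℕ t * fromℕ a) * fromℕ d ⁻¹       ≈⟨ *-assoc _ _ _ ⟩
      fromℕ t * (fromℕ a * fromℕ d ⁻¹)       ≈⟨ *-congˡ (*-comm _ _) ⟩
      fromℕ t * (fromℕ d ⁻¹ * fromℕ a)       ≈⟨ sym (*-assoc _ _ _) ⟩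
      (fromℕ t * fromℕ d ⁻¹) * fromℕ a       ∎

  indicator-product : ∀ b₁ b₂ → (if b₁ then 1# else 0#) * (1# - (if b₂ then 1# else 0#)) ≈ fromℕ (𝟙 (b₁ ∧ not b₂))
  indicator-product true  true  = trans (*-identityˡ _) (-‿inverseʳ 1#)
  indicator-product true  false = trans (*-identityˡ _) (trans (+-congˡ ε⁻¹≈ε) (trans (+-identityʳ _) (sym (+-identityʳ _))))
  indicator-product false b₂    = zeroˡ _

module Theorem {c ℓ c' ℓ'} (𝔽 : FiniteField c ℓ) (m N : ℕ) (v : Fin N → LinAlg.Vecⁿ 𝔽 (suc (suc m)))
  (isLines : LinAlg.IsLineEnumeration 𝔽 v) (K : Field c' ℓ') (char0 : CharacteristicZero K)
  (basis? : (t : Vec (Fin N) (suc (suc m))) → Dec (LinAlg.IsBasis 𝔽 (λ a → v (lookup t a)))) where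

  private
    module 𝔽F = FiniteField 𝔽
    module 𝔽R = CommutativeRing 𝔽F.commRing
    module KR = CommutativeRing (Field.commRing K)
    module KO = RingOps (Field.commRing K)
    module KS = RingSums (Field.commRing K)

  open Counting
  open import Data.Nat as ℕ using (ℕ; zero; suc; _^_; _!; ≢-nonZero⁻¹)
  open import Data.Nat.Properties using (*-identityʳ; *-zeroʳ; suc-injective; +-comm; _!≢0)
  open import Data.Bool using (true; false; if_then_else_)
  open import Data.List using ([]; _∷_; map)
  open import Data.Vec using (toList) renaming ([] to []v; _∷_ to _∷v_)
  open import Data.Product using (Σ; _,_; proj₁)
  open import Data.Empty using (⊥-elim)
  open import Relation.Nullary using (¬_; yes; no; does)
  open import Relation.Binary.PropositionalEquality as ≡ using (_≡_)

  n : ℕ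
  n = suc (suc m)

  i₀ : Fin N
  i₀ = proj₁ (LineEnumeration.v-covers 𝔽 v isLines e₀ e₀≉0)
    where
    e₀ = RingSums.stdBasis 𝔽F.commRing {n} fz
    e₀≉0 : ¬ LinAlg.IsZeroVec 𝔽 e₀
    e₀≉0 e₀≈0 = 𝔽F.0≉1 (𝔽R.sym (e₀≈0 fz))

  open BasisExtensions 𝔽 v isLines i₀
  open HessianEvaluation (Field.commRing K) N using (lowered; hessian-at-1)
  open FieldFacts K
  open QAnalogues using (module Q≥2)

  q≥2 : Σ ℕ λ r → 𝔽F.q ≡ suc (suc r)
  q≥2 = two-codes (code 𝔽R.0#) (code 𝔽R.1#)
    (λ e → 𝔽F.0≉1 (𝔽R.trans (𝔽R.sym (code-correct 𝔽R.0#)) (𝔽R.trans (𝔽R.reflexive (≡.cong 𝔽F.enum e)) (code-correct 𝔽R.1#))))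
    where
    two-codes : ∀ {q} (a b : Fin q) → ¬ a ≡ b → Σ ℕ λ r → q ≡ suc (suc r)
    two-codes {suc zero}    fz fz a≢b = ⊥-elim (a≢b ≡.refl)
    two-codes {suc (suc r)} _  _  _   = r , ≡.refl

  exponents-mem : ∀ {k} (t : Vec (Fin N) k) → Nodup (toList t) → ∀ x → exponents t x ≡ 𝟙 (mem x (toList t))
  exponents-mem []v       _             x = ≡.refl
  exponents-mem (y ∷v t) (y∉t ∷ ndt) x with y ≟F x | x ≟F y
  ... | yes ≡.refl | yes _      = ≡.cong suc (≡.trans (exponents-mem t ndt y) (≡.cong 𝟙 y∉t))
  ... | yes ≡.refl | no x≢x     = ⊥-elim (x≢x ≡.refl)
  ... | no y≢y     | yes ≡.refl = ⊥-elim (y≢y ≡.refl)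
  ... | no _       | no _       = exponents-mem t ndt x

  hessianSummand : Fin N → Fin N → Vec (Fin N) n → ℕ
  hessianSummand i j t = if does (basis? t) then lowered j (exponents t) i ℕ.* exponents t j else 0

  H≈sum : ∀ i j → KR._≈_ (Setup.H-at-1 𝔽 K v basis? i j) (KO.fromℕ (sumL (hessianSummand i j) (choose n allLines)))
  H≈sum i j = hessian-at-1 (λ t → does (basis? t)) exponents (choose n allLines) i j

  summand-offDiagonal : ∀ i j → ¬ i ≡ j → ∀ t → Nodup (toList t) → hessianSummand i j t ≡ throughᵇ i j (toList t)
  summand-offDiagonal i j i≢j t ndt with i ≟F j
  ... | yes i≡j = ⊥-elim (i≢j i≡j)
  ... | no _ rewrite exponents-mem t ndt i | exponents-mem t ndt j | does-basis≡indepᵇ v t (basis? t)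
        with indepᵇ (map v (toList t))
  ...   | true  = ≡.cong (𝟙 (mem i (toList t)) ℕ.*_) (≡.sym (*-identityʳ _))
  ...   | false = ≡.sym (≡.trans (≡.cong (𝟙 (mem i (toList t)) ℕ.*_) (*-zeroʳ (𝟙 (mem j (toList t))))) (*-zeroʳ (𝟙 (mem i (toList t)))))

  -- On the diagonal the exponent is lowered first, and a squarefree monomial has ∂ᵢ² = 0.
  summand-diagonal : ∀ i t → Nodup (toList t) → hessianSummand i i t ≡ 0
  summand-diagonal i t ndt with i ≟F i
  ... | no i≢i = ⊥-elim (i≢i ≡.refl)
  ... | yes _ rewrite exponents-mem t ndt i with does (basis? t) | mem i (toList t)
  ...   | false | _     = ≡.refl
  ...   | true  | true  = ≡.refl
  ...   | true  | false = ≡.refl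

  H-offDiagonal : ∀ i j → ¬ i ≡ j → sumL (hessianSummand i j) (choose n allLines) ≡ #basesThrough i j m
  H-offDiagonal i j i≢j = sumL-congAll (choose-chosenFrom allLines allLines-Nodup n)
    (λ t chosen → summand-offDiagonal i j i≢j t (proj₁ chosen))

  H-diagonal : ∀ i → sumL (hessianSummand i i) (choose n allLines) ≡ 0
  H-diagonal i = ≡.trans (sumL-congAll (choose-chosenFrom allLines allLines-Nodup n)
    (λ t chosen → summand-diagonal i t (proj₁ chosen))) (sumL-zero (choose n allLines))

  AB≈count : ∀ i j → KR._≈_ (Setup.AB 𝔽 K v i j) (KO.fromℕ (count lines (λ k → ABᵇ i j (v k))))
  AB≈count i j = KR.trans (KS.∑-cong (λ k → indicator-product (orthᵇ (v i) (v k)) (orthᵇ (v k) (v j))))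
                          (KS.∑-fromℕ (λ k → 𝟙 (ABᵇ i j (v k))))

  AB-diagonal : ∀ i → count lines (λ k → ABᵇ i i (v k)) ≡ 0
  AB-diagonal i = ≡.trans (sumL-cong allLines excluded) (sumL-zero allLines)
    where
    excluded : ∀ k → 𝟙 (ABᵇ i i (v k)) ≡ 0
    excluded k rewrite orthᵇ-comm (v k) (v i) with orthᵇ (v i) (v k)
    ... | true  = ≡.refl
    ... | false = ≡.refl

  module _ (r : ℕ) (q≡ : 𝔽F.q ≡ suc (suc r)) where

    open Q≥2 r

    #𝔽ˣ≡ : #𝔽ˣ ≡ Q∸1
    #𝔽ˣ≡ = suc-injective (≡.trans (+-comm 1 #𝔽ˣ) (≡.trans count-nonzero q≡))

    -- |v_i⊥ ∖ v_j⊥| = q^(n-1) − q^(n-2) nonzero vectors, i.e. q^(n-2) lines.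
    #AB-lines : ∀ i j → ¬ i ≡ j → count lines (λ k → ABᵇ i j (v k)) ≡ Q ^ m
    #AB-lines i j i≢j = kernel-sizes-arith m _ _ _
      (≡.subst (λ y → count (𝔽ⁿ-enum n) (λ cv → inKernelᵇ (v i ∷ []) ⟦ cv ⟧) ℕ.* y ℕ.^ 1 ≡ y ℕ.^ n) q≡
               (count-kernel₁ (v i) (v-nonzero i)))
      (≡.subst (λ y → count (𝔽ⁿ-enum n) (λ cv → inKernelᵇ (v i ∷ v j ∷ []) ⟦ cv ⟧) ℕ.* y ℕ.^ 2 ≡ y ℕ.^ n) q≡
               (count-kernel₂ (v i) (v j) (v-nonzero i) (v-nonzero j) (distinct-lines i j i≢j) (distinct-lines j i (λ e → i≢j (≡.sym e)))))
      (≡.subst (λ x → count (𝔽ⁿ-enum n) (λ cv → inKernelᵇ (v i ∷ v j ∷ []) ⟦ cv ⟧) ℕ.+ count lines (λ k → ABᵇ i j (v k)) ℕ.* x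
                        ≡ count (𝔽ⁿ-enum n) (λ cv → inKernelᵇ (v i ∷ []) ⟦ cv ⟧)) #𝔽ˣ≡ (count-AB-lines i j))

    #basesThrough-closed : ∀ i j → ¬ i ≡ j → #basesThrough i j m ℕ.* m ! ≡ t-coeff n Q ℕ.* Q ^ m
    #basesThrough-closed i j i≢j = completions-t-coeff m (#basesThrough i j m)
      (≡.subst₂ (λ x y → #basesThrough i j m ℕ.* (m ! ℕ.* x ℕ.^ m) ≡ QAnalogues.completions y n 2 m) #𝔽ˣ≡ q≡
                (#basesThrough-count i j m i≢j))

  m!≉0 : ¬ KR._≈_ (KO.fromℕ (m !)) KR.0#
  m!≉0 m!≈0 = ≢-nonZero⁻¹ (m !) {{m !≢0}} (char0 (m !) m!≈0)

  entry : ∀ i j → KR._≈_ (Setup.H-at-1 𝔽 K v basis? i j) (Setup.scalar 𝔽 K n KR.* Setup.AB 𝔽 K v i j)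
  entry i j with i ≟F j | q≥2
  ... | yes ≡.refl | _ = KR.trans (H≈sum i i) (KR.trans (KR.reflexive (≡.cong KO.fromℕ (H-diagonal i)))
          (KR.sym (KR.trans (KR.*-congˡ (KR.trans (AB≈count i i) (KR.reflexive (≡.cong KO.fromℕ (AB-diagonal i))))) (KR.zeroʳ _))))
  ... | no i≢j | r , q≡ = KR.trans (H≈sum i j) (KR.trans (KR.reflexive (≡.cong KO.fromℕ (H-offDiagonal i j i≢j)))
          (KR.trans (fromℕ-quotient (#basesThrough i j m) (t-coeff n 𝔽F.q) (count lines (λ k → ABᵇ i j (v k))) (m !) bases m!≉0) (KR.*-congˡ (KR.sym (AB≈count i j)))))
    where
    bases : #basesThrough i j m ℕ.* m ! ≡ t-coeff n 𝔽F.q ℕ.* count lines (λ k → ABᵇ i j (v k))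
    bases = ≡.trans (#basesThrough-closed r q≡ i j i≢j)
      (≡.trans (≡.cong (λ y → t-coeff n y ℕ.* Q≥2.Q r ^ m) (≡.sym q≡)) (≡.cong (t-coeff n 𝔽F.q ℕ.*_) (≡.sym (#AB-lines r q≡ i j i≢j))))

open import Level using (Level)
open import Data.Nat using (_≤_; _*_; _∸_; _^_; s≤s; z≤n)
open import Relation.Binary.PropositionalEquality using (_≡_)

theorem4p11 : ∀ {c ℓ c' ℓ' : Level}
    (𝔽 : FiniteField c ℓ) (n : ℕ) → 2 ≤ n →
    (N : ℕ) → N * (FiniteField.q 𝔽 ∸ 1) ≡ FiniteField.q 𝔽 ^ n ∸ 1 →
    (v : Fin N → LinAlg.Vecⁿ 𝔽 n) → LinAlg.IsLineEnumeration 𝔽 v →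
    (K : Field c' ℓ') → CharacteristicZero K →
    (basis? : (t : Vec (Fin N) n) → Dec (LinAlg.IsBasis 𝔽 (λ a → v (lookup t a)))) →
    ∀ (i j : Fin N) →
    CommutativeRing._≈_ (Field.commRing K)
      (Setup.H-at-1 𝔽 K v basis? i j)
      (CommutativeRing._*_ (Field.commRing K) (Setup.scalar 𝔽 K n) (Setup.AB 𝔽 K v i j))
theorem4p11 𝔽 (suc (suc m)) (s≤s (s≤s z≤n)) N _ v isLines K char0 basis? =
  Theorem.entry 𝔽 m N v isLines K char0 basis?
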